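{- Let $k\ge 2$. The eigenvalue of $M(2k)$ belonging to the $\chi_{[2k]}$-module is $d(2k)$, and the eigenvalue of $M(2k)$ belonging to the $\chi_{[2k-2,2]}$-module is $-d(2k)/(2k-2)$.
   Context: A perfect matching of $K_{2k}$ is a set of $k$ pairwise vertex-disjoint edges of the complete graph on $\{1,\dots,2k\}$. $M(2k)$ is the graph whose vertices are the perfect matchings of $K_{2k}$, two adjacent iff they share no edge; $d(2k)$ is its (constant) degree. $\mathrm{Sym}(2k)$ acts on perfect matchings via its action on $\{1,\dots,2k\}$, making $\mathbb{R}^{V(M(2k))}$ a $\mathrm{Sym}(2k)$-module. For a partition $\lambda=(\lambda_1,\dots,\lambda_\ell)$ of $k$ write $2\lambda=(2\lambda_1,\dots,2\lambda_\ell)$. This permutation module decomposes as a direct sum $\bigoplus_{\lambda\vdash k}W_{2\lambda}$, where $W_{2\lambda}$ is the unique submodule isomorphic to the irreducible $\mathrm{Sym}(2k)$-module indexed by $2\lambda$ (each occurs with multiplicity one), called the $\chi_{2\lambda}$-module. The adjacency matrix of $M(2k)$ commutes with the action and hence acts on each $W_{2\lambda}$ as a scalar $\xi_{2\lambda}$, called the eigenvalue belonging to the $\chi_{2\lambda}$-module.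
   Formalization: The coefficient field is ℚ rather than ℝ: the permutation module on perfect matchings, the irreducible modules indexed by $2\lambda$ and the maps identifying them with submodules are all taken over the rationals. -}

module Defs where

open import Data.Nat as ℕ using (ℕ; zero; suc; _≤_; s≤s; z≤n)
open import Data.Nat.Properties using (+-suc)
open import Data.Integer using (+_)
open import Data.Rational using (ℚ; _+_; _*_; -_; 0ℚ; 1ℚ; _/_)
open import Data.Fin using (Fin)
open import Data.Fin.Properties as FinP using (all?)
open import Data.Fin.Permutation using (Permutation′; _⟨$⟩ʳ_; _⟨$⟩ˡ_)
open import Data.Fin.Subset using (Subset; ∣_∣; ⁅_⁆; _∪_)
open import Data.Vec using (Vec; []; _∷_; lookup; tabulate)
open import Data.Vec.Properties using (≡-dec)
open import Data.Bool using (Bool)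
open import Data.Bool.Properties as BoolP using ()
open import Data.List using (List; []; _∷_; [_]; concatMap; map; filter; length; foldr; allFin)
open import Data.List.Relation.Unary.All using (All)
open import Data.Product using (_×_; _,_; Σ; ∃)
open import Relation.Nullary using (¬_; Dec; yes; no)
open import Relation.Nullary.Decidable using (_×-dec_; ¬?)
open import Relation.Binary.PropositionalEquality using (_≡_; _≢_; refl)
open import Level using (0ℓ)
import Level

-- Perfect matchings of K_n, encoded as fixed-point-free involutions
-- of Fin n, stored as a lookup table (Vec (Fin n) n) so that equality
-- is decidable.  The edges of m are the pairs {i , m i}.

Table : ℕ → Set
Table n = Vec (Fin n) n

IsPM : ∀ {n} → Table n → Set
IsPM {n} m = ∀ (i : Fin n) → (lookup m (lookup m i) ≡ i) × (lookup m i ≢ i)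

isPM? : ∀ {n} (m : Table n) → Dec (IsPM m)
isPM? {n} m = all? (λ i → (lookup m (lookup m i) FinP.≟ i) ×-dec ¬? (lookup m i FinP.≟ i))

allTables : ∀ n l → List (Vec (Fin n) l)
allTables n zero = [ [] ]
allTables n (ℕ.suc l) = concatMap (λ x → map (x ∷_) (allTables n l)) (allFin n)

matchings : ∀ n → List (Table n)
matchings n = filter isPM? (allTables n n)

-- two perfect matchings share no edge
-- (they share an edge iff some vertex has the same partner in both)
Disjoint : ∀ {n} → Table n → Table n → Set
Disjoint {n} m m' = ∀ (i : Fin n) → lookup m i ≢ lookup m' i

disjoint? : ∀ {n} (m m' : Table n) → Dec (Disjoint m m')
disjoint? m m' = all? (λ i → ¬? (lookup m i FinP.≟ lookup m' i))

neighbours : ∀ {n} → Table n → List (Table n)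
neighbours {n} m = filter (disjoint? m) (matchings n)

degree : ∀ {n} → Table n → ℕ
degree m = length (neighbours m)

-- The permutation module Q^{V(M(n))}: functions on tables, only their
-- values on perfect matchings matter.

sumℚ : List ℚ → ℚ
sumℚ = foldr _+_ 0ℚ

Vtx : ℕ → Set
Vtx n = Table n → ℚ

_≈V_ : ∀ {n} → Vtx n → Vtx n → Set
_≈V_ {n} f g = ∀ (m : Table n) → IsPM m → f m ≡ g m

_+V_ : ∀ {n} → Vtx n → Vtx n → Vtx n
(f +V g) m = f m + g m

_·V_ : ∀ {n} → ℚ → Vtx n → Vtx n
(q ·V f) m = q * f m

actPM : ∀ {n} → Permutation′ n → Table n → Table n
actPM σ m = tabulate (λ i → σ ⟨$⟩ʳ lookup m (σ ⟨$⟩ˡ i))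

_⋆V_ : ∀ {n} → Permutation′ n → Vtx n → Vtx n
(σ ⋆V f) m = f (tabulate (λ i → σ ⟨$⟩ˡ lookup m (σ ⟨$⟩ʳ i)))

adj : ∀ {n} → Vtx n → Vtx n
adj f m = sumℚ (map f (neighbours m))

-- Q-representations of Sym(n) presented as a subset of a carrier,
-- with an equality, linear structure and an action.

record SymRep (n : ℕ) : Set₁ where
  field
    Carrier : Set
    In      : Carrier → Set
    _≈_     : Carrier → Carrier → Set
    _⊕_     : Carrier → Carrier → Carrier
    _⊙_     : ℚ → Carrier → Carrier
    act     : Permutation′ n → Carrier → Carrier

-- F is an injective Sym(n)-equivariant Q-linear map from R into Q^{V(M(n))};
-- its image is then a submodule of Q^{V(M(n))} isomorphic to R.
record IsEmbedding {n} (R : SymRep n) (F : SymRep.Carrier R → Vtx n) : Set where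
  open SymRep R
  field
    resp  : ∀ {x y} → In x → In y → x ≈ y → F x ≈V F y
    add   : ∀ {x y} → In x → In y → F (x ⊕ y) ≈V (F x +V F y)
    scal  : ∀ {x} (q : ℚ) → In x → F (q ⊙ x) ≈V (q ·V F x)
    equiv : ∀ {x} (σ : Permutation′ n) → In x → F (act σ x) ≈V (σ ⋆V F x)
    inj   : ∀ {x y} → In x → In y → F x ≈V F y → x ≈ y

-- W is the submodule of Q^{V(M(n))} isomorphic to R on which adj acts as ξ:
-- every embedding of R has image on which adj is multiplication by ξ.
EigenvalueOn : ∀ {n} → SymRep n → ℚ → Set
EigenvalueOn {n} R ξ =
  (F : SymRep.Carrier R → Vtx n) → IsEmbedding R F →
  ∀ x → SymRep.In R x → adj (F x) ≈V (ξ ·V F x)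

-- Specht module S^[n]: the trivial module Q.

trivialRep : ∀ n → SymRep n
trivialRep n = record
  { Carrier = ℚ ; In = λ _ → Level.Lift 0ℓ Data.Unit.⊤ ; _≈_ = _≡_
  ; _⊕_ = _+_ ; _⊙_ = _*_ ; act = λ _ q → q }
  where import Data.Unit

-- Specht module S^[n-2,2] inside the permutation module M^[n-2,2] on
-- tabloids of shape (n-2,2); a tabloid is determined by its second row,
-- a 2-subset of Fin n.

Tab : ℕ → Set
Tab n = Subset n → ℚ

_⋆T_ : ∀ {n} → Permutation′ n → Tab n → Tab n
(σ ⋆T u) s = u (tabulate (λ i → lookup s (σ ⟨$⟩ʳ i)))

pair : ∀ {n} → Fin n → Fin n → Subset n
pair x y = ⁅ x ⁆ ∪ ⁅ y ⁆

indicator : ∀ {n} → Subset n → Subset n → ℚ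
indicator t s with ≡-dec BoolP._≟_ s t
... | yes _ = 1ℚ
... | no _  = 0ℚ

-- polytabloid e_T for a tableau T of shape (n-2,2) whose two columns are
-- (a over c) and (b over d) (other columns have length 1):
-- e_T = Σ_{π ∈ C_T} sgn(π) {πT} = {cd} - {ad} - {cb} + {ab}
-- (tabloids named by their second row)
polytabloid : ∀ {n} → Fin n → Fin n → Fin n → Fin n → Tab n
polytabloid a b c d s =
  ((indicator (pair c d) s + - indicator (pair a d) s)
     + - indicator (pair c b) s) + indicator (pair a b) s

Distinct4 : ∀ {n} → Fin n → Fin n → Fin n → Fin n → Set
Distinct4 a b c d = (a ≢ b) × (a ≢ c) × (a ≢ d) × (b ≢ c) × (b ≢ d) × (c ≢ d)

Quad : ℕ → Set
Quad n = Fin n × Fin n × Fin n × Fin n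

ValidQuad : ∀ {n} → ℚ × Quad n → Set
ValidQuad (_ , a , b , c , d) = Distinct4 a b c d

combo : ∀ {n} → List (ℚ × Quad n) → Tab n
combo L s = sumℚ (map (λ { (q , a , b , c , d) → q * polytabloid a b c d s }) L)

_≈T_ : ∀ {n} → Tab n → Tab n → Set
_≈T_ {n} u v = ∀ (s : Subset n) → ∣ s ∣ ≡ 2 → u s ≡ v s

InSpecht : ∀ {n} → Tab n → Set
InSpecht {n} u = Σ (List (ℚ × Quad n)) (λ L → All ValidQuad L × (u ≈T combo L))

spechtRep : ∀ n → SymRep n
spechtRep n = record
  { Carrier = Tab n ; In = InSpecht ; _≈_ = _≈T_
  ; _⊕_ = λ u v s → u s + v s ; _⊙_ = λ q u s → q * u s ; act = _⋆T_ }

nz : ∀ {k} → 2 ≤ k → ℕ.NonZero (2 ℕ.* k ℕ.∸ 2)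
nz {suc (suc j)} (s≤s (s≤s _)) rewrite +-suc j (suc (j ℕ.+ 0)) = _

negRatio : ∀ k → 2 ≤ k → ℕ → ℚ
negRatio k h d = - (_/_ (+ d) (2 ℕ.* k ℕ.∸ 2) {{nz h}})

-- A function h on matchings that is
-- invariant under the transpositions of points outside a set X takes the same value on
-- any two matchings with the same edges inside X, since such transpositions connect them.
-- For the trivial module (X = ∅) the image of an embedding is therefore constant, and the
-- adjacency operator multiplies it by the degree.  For S^(n-2,2), let e_T be a polytabloid
-- with columns (a, c) and (b, d), and X = {a, b, c, d}: equivariance, the column relations
-- and the Garnir relation force the image of e_T to be (β/2) E_T, where
-- E_T(m) = [cd ∈ m] - [ad ∈ m] - [cb ∈ m] + [ab ∈ m] and β is the value on a matching
-- containing ab and cd.  The number of neighbours of m containing an edge xy is 0 if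
-- xy ∈ m and N = d/(n-2) otherwise, so the constant parts cancel and adj E_T = -N E_T.

module Submission where

open import Defs
open import Data.Nat as ℕ using (ℕ; zero; suc; _≤_; _<_; z≤n; s≤s)
import Data.Nat.Properties as ℕ
open import Data.Fin using (Fin; zero; suc)
open import Data.Fin.Permutation using (transpose)
open import Data.Fin.Subset using (Subset; ⁅_⁆)
open import Data.Bool using (false; _∨_)
import Data.Bool.Properties as Bool
open import Data.Fin.Properties using (_≟_; all?; ¬∀⟶∃¬)
import Data.Fin.Permutation.Components as PC
open import Data.Vec using (Vec; []; _∷_; lookup; tabulate)
open import Data.Vec.Relation.Binary.Pointwise.Extensional using (ext; Pointwise-≡⇒≡)
open import Data.Vec.Properties using (lookup∘tabulate; tabulate-cong; ∷-injective; ≡-dec; lookup-replicate; lookup-zipWith)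
open import Data.List as List using (List; []; _∷_; map; filter; length; allFin; concatMap; cartesianProductWith)
open import Data.List.Properties using (filter-≐; filter-none; filter-all; filter-some; length-tabulate)
open import Data.List.Membership.Propositional using (_∈_)
open import Data.List.Membership.Propositional.Properties
  using (∈-map⁺; ∈-cartesianProductWith⁺; ∈-allFin; ∈-filter⁺; ∈-filter⁻)
open import Data.List.Membership.Propositional.Properties.WithK using (unique∧set⇒bag)
open import Data.List.Relation.Unary.Any as Any using (here; there)
open import Data.List.Relation.Unary.All as All using (All; []; _∷_)
open import Data.List.Relation.Unary.AllPairs using ([]; _∷_)
open import Data.List.Relation.Unary.Unique.Propositional using (Unique)
import Data.List.Relation.Unary.Unique.Propositional.Properties as Unique
open import Data.List.Relation.Binary.BagAndSetEquality using (∼bag⇒↭)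
open import Data.List.Relation.Binary.Permutation.Propositional using (_↭_)
open import Data.List.Relation.Binary.Permutation.Propositional.Properties using (filter-↭; ↭-length)
open import Data.Product using (_×_; _,_; proj₁; proj₂; ∃)
open import Data.Sum using (_⊎_; inj₁; inj₂; [_,_])
open import Data.Empty using (⊥; ⊥-elim)
open import Function using (_∘_)
open import Function.Bundles using (mk⇔)
open import Relation.Nullary using (¬_; Dec; yes; no; does)
open import Relation.Nullary.Decidable using (dec-true; dec-false; ¬?; _×-dec_; _⊎-dec_)
open import Relation.Unary using (Pred; Decidable)
open import Data.Integer as ℤ using (+_)
import Data.Integer.Properties as ℤ
open import Data.Rational using (ℚ; _+_; _*_; -_; 0ℚ; 1ℚ; ½; _/_; toℚᵘ)
open import Data.Rational.Properties
  using (toℚᵘ-injective; toℚᵘ-fromℚᵘ; toℚᵘ-homo-+; fromℚᵘ-cong; +-identityʳ; *-identityˡ; *-zeroˡ)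
open import Data.Rational.Unnormalised using (mkℚᵘ; *≡*)
import Data.Rational.Unnormalised.Properties as ℚᵘ
open import Data.Rational.Solver using (module +-*-Solver)
open +-*-Solver using (solve; _:+_; _:*_; :-_; _:=_; con)
open import Relation.Binary.PropositionalEquality hiding ([_]; resp)
import Level

private variable n : ℕ

swap : Fin n → Fin n → Fin n → Fin n
swap = PC.transpose

swap-matchˡ : (i j : Fin n) → swap i j i ≡ j
swap-matchˡ i j rewrite dec-true (i ≟ i) refl = refl

swap-matchʳ : (i j : Fin n) → swap i j j ≡ i
swap-matchʳ i j with j ≟ i
... | yes j≡i = j≡i
... | no j≢i rewrite dec-true (j ≟ j) refl = refl

swap-mismatch : (i j : Fin n) {k : Fin n} → k ≢ i → k ≢ j → swap i j k ≡ k
swap-mismatch i j {k} k≢i k≢j rewrite dec-false (k ≟ i) k≢i | dec-false (k ≟ j) k≢j = refl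

data SwapView {n} (i j k : Fin n) : Set where
  at-i      : k ≡ i → SwapView i j k
  at-j      : k ≡ j → k ≢ i → SwapView i j k
  elsewhere : k ≢ i → k ≢ j → SwapView i j k

swapView : (i j k : Fin n) → SwapView i j k
swapView i j k with k ≟ i | k ≟ j
... | yes k≡i | _       = at-i k≡i
... | no k≢i  | yes k≡j = at-j k≡j k≢i
... | no k≢i  | no k≢j  = elsewhere k≢i k≢j

swap-involutive : (i j k : Fin n) → swap i j (swap i j k) ≡ k
swap-involutive i j k with swapView i j k
... | at-i refl    rewrite swap-matchˡ k j = swap-matchʳ k j
... | at-j refl _  rewrite swap-matchʳ i k = swap-matchˡ i k
... | elsewhere p q rewrite swap-mismatch i j p q = swap-mismatch i j p q

swap-comm : (i j k : Fin n) → swap j i k ≡ swap i j k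
swap-comm i j k with swapView i j k
... | at-i refl    rewrite swap-matchˡ k j = swap-matchʳ j k
... | at-j refl _  rewrite swap-matchʳ i k = swap-matchˡ k i
... | elsewhere p q rewrite swap-mismatch i j p q = swap-mismatch j i q p

Involution : (Fin n → Fin n) → Set
Involution s = ∀ i → s (s i) ≡ i

involution-injective : (s : Fin n → Fin n) → Involution s → ∀ {x y} → s x ≡ s y → x ≡ y
involution-injective s inv {x} {y} e = trans (sym (inv x)) (trans (cong s e) (inv y))

-- the table of the matching s·m, for an involution s
conjugate : (Fin n → Fin n) → Table n → Table n
conjugate s m = tabulate (λ i → s (lookup m (s i)))

lookup-conjugate : (s : Fin n → Fin n) (m : Table n) (i : Fin n) →
                   lookup (conjugate s m) i ≡ s (lookup m (s i))
lookup-conjugate s m = lookup∘tabulate _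

lookup-ext : {A : Set} {u v : Vec A n} → (∀ i → lookup u i ≡ lookup v i) → u ≡ v
lookup-ext h = Pointwise-≡⇒≡ (ext h)

conjugate-isPM : (s : Fin n → Fin n) → Involution s → (m : Table n) → IsPM m → IsPM (conjugate s m)
conjugate-isPM s inv m pm i = twice , moved
  where
  open ≡-Reasoning
  twice : lookup (conjugate s m) (lookup (conjugate s m) i) ≡ i
  twice = begin
    lookup (conjugate s m) (lookup (conjugate s m) i) ≡⟨ lookup-conjugate s m _ ⟩
    s (lookup m (s (lookup (conjugate s m) i)))       ≡⟨ cong (λ z → s (lookup m (s z))) (lookup-conjugate s m i) ⟩
    s (lookup m (s (s (lookup m (s i)))))             ≡⟨ cong (s ∘ lookup m) (inv _) ⟩
    s (lookup m (lookup m (s i)))                     ≡⟨ cong s (proj₁ (pm (s i))) ⟩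
    s (s i)                                           ≡⟨ inv i ⟩
    i                                                 ∎
  moved : lookup (conjugate s m) i ≢ i
  moved e = proj₂ (pm (s i)) (trans (sym (inv _)) (cong s (trans (sym (lookup-conjugate s m i)) e)))

conjugate-involutive : (s : Fin n → Fin n) → Involution s → (m : Table n) → conjugate s (conjugate s m) ≡ m
conjugate-involutive s inv m = lookup-ext λ i → begin
  lookup (conjugate s (conjugate s m)) i ≡⟨ lookup-conjugate s (conjugate s m) i ⟩
  s (lookup (conjugate s m) (s i))       ≡⟨ cong s (lookup-conjugate s m (s i)) ⟩
  s (s (lookup m (s (s i))))             ≡⟨ inv _ ⟩
  lookup m (s (s i))                     ≡⟨ cong (lookup m) (inv i) ⟩
  lookup m i                             ∎
  where open ≡-Reasoning

conjugate-disjoint : (s : Fin n → Fin n) → Involution s → (m m′ : Table n) →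
                     Disjoint m m′ → Disjoint (conjugate s m) (conjugate s m′)
conjugate-disjoint s inv m m′ d i e =
  d (s i) (involution-injective s inv (trans (sym (lookup-conjugate s m i)) (trans e (lookup-conjugate s m′ i))))

module _ (j k : Fin n) (m : Table n) where

  lookup-conjugate-swapˡ : lookup (conjugate (swap j k) m) j ≡ swap j k (lookup m k)
  lookup-conjugate-swapˡ = trans (lookup-conjugate (swap j k) m j) (cong (swap j k ∘ lookup m) (swap-matchˡ j k))

  lookup-conjugate-swapʳ : lookup (conjugate (swap j k) m) k ≡ swap j k (lookup m j)
  lookup-conjugate-swapʳ = trans (lookup-conjugate (swap j k) m k) (cong (swap j k ∘ lookup m) (swap-matchʳ j k))

  lookup-conjugate-swap-mismatch : ∀ {z} → z ≢ j → z ≢ k → lookup (conjugate (swap j k) m) z ≡ swap j k (lookup m z)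
  lookup-conjugate-swap-mismatch z≢j z≢k =
    trans (lookup-conjugate (swap j k) m _) (cong (swap j k ∘ lookup m) (swap-mismatch j k z≢j z≢k))

partner-sym : (m : Table n) → IsPM m → ∀ {x y} → lookup m x ≡ y → lookup m y ≡ x
partner-sym m pm {x} e = trans (cong (lookup m) (sym e)) (proj₁ (pm x))

partner-injective : (m : Table n) → IsPM m → ∀ {x y} → lookup m x ≡ lookup m y → x ≡ y
partner-injective m pm {x} {y} e = trans (sym (proj₁ (pm x))) (trans (cong (lookup m) e) (proj₁ (pm y)))

conjugate-edge : (m : Table n) → IsPM m → ∀ {j k} → lookup m j ≡ k → conjugate (swap j k) m ≡ m
conjugate-edge m pm {j} {k} mj≡k = lookup-ext λ z → trans (lookup-conjugate (swap j k) m z) (fixed z)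
  where
  mk≡j : lookup m k ≡ j
  mk≡j = partner-sym m pm mj≡k
  fixed : ∀ z → swap j k (lookup m (swap j k z)) ≡ lookup m z
  fixed z with swapView j k z
  ... | at-i refl rewrite swap-matchˡ z k | mk≡j | swap-matchˡ z k = sym mj≡k
  ... | at-j refl _ rewrite swap-matchʳ j z | mj≡k | swap-matchʳ j z = sym mk≡j
  ... | elsewhere p q rewrite swap-mismatch j k p q =
    swap-mismatch j k (λ e → q (trans (sym (partner-sym m pm e)) mj≡k))
                      (λ e → p (trans (sym (partner-sym m pm e)) mk≡j))

matching-with-edges : {m₀ : Table n} → IsPM m₀ → {a b c d : Fin n} → Distinct4 a b c d →
                      ∃ λ m → IsPM m × lookup m a ≡ b × lookup m c ≡ d
matching-with-edges {m₀ = m₀} pm₀ {a} {b} {c} {d} (a≢b , a≢c , a≢d , b≢c , b≢d , c≢d) = m₂ , pm₂ , m₂a , m₂c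
  where
  j₁ = lookup m₀ a
  m₁ = conjugate (swap j₁ b) m₀
  pm₁ = conjugate-isPM (swap j₁ b) (swap-involutive j₁ b) m₀ pm₀
  m₁a : lookup m₁ a ≡ b
  m₁a = trans (lookup-conjugate-swap-mismatch j₁ b m₀ (≢-sym (proj₂ (pm₀ a))) a≢b) (swap-matchˡ j₁ b)
  j₂ = lookup m₁ c
  m₂ = conjugate (swap j₂ d) m₁
  pm₂ = conjugate-isPM (swap j₂ d) (swap-involutive j₂ d) m₁ pm₁
  a≢j₂ : a ≢ j₂
  a≢j₂ e = b≢c (trans (sym m₁a) (partner-sym m₁ pm₁ (sym e)))
  b≢j₂ : b ≢ j₂
  b≢j₂ e = a≢c (trans (sym (partner-sym m₁ pm₁ m₁a)) (partner-sym m₁ pm₁ (sym e)))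
  m₂a : lookup m₂ a ≡ b
  m₂a = trans (lookup-conjugate-swap-mismatch j₂ d m₁ a≢j₂ a≢d)
              (trans (cong (swap j₂ d) m₁a) (swap-mismatch j₂ d b≢j₂ b≢d))
  m₂c : lookup m₂ c ≡ d
  m₂c = trans (lookup-conjugate-swap-mismatch j₂ d m₁ (≢-sym (proj₂ (pm₁ c))) c≢d) (swap-matchˡ j₂ d)

count : {A : Set} {P : Pred A Level.zero} → Decidable P → List A → ℕ
count P? L = length (filter P? L)

module _ {A : Set} {P : Pred A Level.zero} (P? : Decidable P) where

  count-none : ∀ {L} → All (¬_ ∘ P) L → count P? L ≡ 0
  count-none h = cong length (filter-none P? h)

  count-all : ∀ {L} → All P L → count P? L ≡ length L
  count-all h = cong length (filter-all P? h)

  count-pos : ∀ {L y} → y ∈ L → P y → 0 < count P? L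
  count-pos y∈L Py = filter-some P? (Any.map (λ { refl → Py }) y∈L)

  count+count-¬ : ∀ L → count P? L ℕ.+ count (¬? ∘ P?) L ≡ length L
  count+count-¬ [] = refl
  count+count-¬ (x ∷ L) with P? x
  ... | yes _ = cong suc (count+count-¬ L)
  ... | no _  = trans (ℕ.+-suc _ _) (cong suc (count+count-¬ L))

count-map : {A B : Set} {P : Pred B Level.zero} (P? : Decidable P) (g : A → B) →
            ∀ L → count P? (map g L) ≡ count (P? ∘ g) L
count-map P? g [] = refl
count-map P? g (x ∷ L) with P? (g x)
... | yes _ = cong suc (count-map P? g L)
... | no _  = count-map P? g L

module _ {A : Set} {P Q : Pred A Level.zero} (P? : Decidable P) (Q? : Decidable Q) where

  count-≐ : (∀ x → P x → Q x) → (∀ x → Q x → P x) → ∀ L → count P? L ≡ count Q? L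
  count-≐ f g L = cong length (filter-≐ P? Q? ((λ {x} → f x) , (λ {x} → g x)) L)

  count-filter : ∀ L → count P? (filter Q? L) ≡ count (λ x → Q? x ×-dec P? x) L
  count-filter [] = refl
  count-filter (x ∷ L) with Q? x
  ... | no _ = count-filter L
  ... | yes _ with P? x
  ... | yes _ = cong suc (count-filter L)
  ... | no _  = count-filter L

  count-⊎ : (∀ x → P x → Q x → ⊥) → ∀ L → count (λ x → P? x ⊎-dec Q? x) L ≡ count P? L ℕ.+ count Q? L
  count-⊎ disj [] = refl
  count-⊎ disj (x ∷ L) with P? x | Q? x
  ... | yes p | yes q = ⊥-elim (disj x p q)
  ... | yes _ | no _  = cong suc (count-⊎ disj L)
  ... | no _  | yes _ = trans (cong suc (count-⊎ disj L)) (sym (ℕ.+-suc _ _))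
  ... | no _  | no _  = count-⊎ disj L

  count-mono : (∀ x → P x → Q x) → ∀ L → count P? L ≤ count Q? L
  count-mono f [] = z≤n
  count-mono f (x ∷ L) with P? x | Q? x
  ... | yes _ | yes _ = s≤s (count-mono f L)
  ... | yes p | no ¬q = ⊥-elim (¬q (f x p))
  ... | no _  | yes _ = ℕ.m≤n⇒m≤1+n (count-mono f L)
  ... | no _  | no _  = count-mono f L

  count-< : (∀ x → P x → Q x) → ∀ L {y} → y ∈ L → Q y → ¬ P y → count P? L < count Q? L
  count-< f (x ∷ L) (here refl) Qy ¬Py with P? x | Q? x
  ... | yes p | _     = ⊥-elim (¬Py p)
  ... | no _  | yes _ = s≤s (count-mono f L)
  ... | no _  | no ¬q = ⊥-elim (¬q Qy)
  count-< f (x ∷ L) (there y∈L) Qy ¬Py with P? x | Q? x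
  ... | yes _ | yes _ = s≤s (count-< f L y∈L Qy ¬Py)
  ... | yes p | no ¬q = ⊥-elim (¬q (f x p))
  ... | no _  | yes _ = ℕ.m≤n⇒m≤1+n (count-< f L y∈L Qy ¬Py)
  ... | no _  | no _  = count-< f L y∈L Qy ¬Py

count-≟ : ∀ {v : Fin n} {L} → Unique L → v ∈ L → count (_≟ v) L ≡ 1
count-≟ {L = x ∷ L} (x∉L ∷ _) (here refl) with x ≟ x
... | yes _  = cong suc (count-none (_≟ x) (All.map (λ x≢y e → x≢y (sym e)) x∉L))
... | no x≢x = ⊥-elim (x≢x refl)
count-≟ {v = v} {L = x ∷ L} (x∉L ∷ uL) (there v∈L) with x ≟ v
... | yes x≡v = ⊥-elim (All.lookup x∉L v∈L x≡v)
... | no _     = count-≟ uL v∈L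

allTables-cartesian : ∀ n l → allTables n (suc l) ≡ cartesianProductWith _∷_ (allFin n) (allTables n l)
allTables-cartesian n l = go (allFin n)
  where
  go : ∀ xs → concatMap (λ x → map (x ∷_) (allTables n l)) xs ≡ cartesianProductWith _∷_ xs (allTables n l)
  go [] = refl
  go (x ∷ xs) = cong (map (x ∷_) (allTables n l) List.++_) (go xs)

∈-allTables : ∀ {n l} (v : Vec (Fin n) l) → v ∈ allTables n l
∈-allTables [] = here refl
∈-allTables {n} {suc l} (x ∷ v) = subst ((x ∷ v) ∈_) (sym (allTables-cartesian n l))
  (∈-cartesianProductWith⁺ _∷_ (∈-allFin x) (∈-allTables v))

allTables-unique : ∀ n l → Unique (allTables n l)
allTables-unique n zero = [] ∷ []
allTables-unique n (suc l) = subst Unique (sym (allTables-cartesian n l))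
  (Unique.cartesianProductWith⁺ _∷_ ∷-injective (Unique.allFin⁺ n) (allTables-unique n l))

-- an involution of tables permutes the enumeration, so it preserves counts
count-involution : (g : Table n → Table n) → (∀ t → g (g t) ≡ t) →
  {P Q : Pred (Table n) Level.zero} (P? : Decidable P) (Q? : Decidable Q) →
  (∀ t → P t → Q (g t)) → (∀ t → Q t → P (g t)) → count P? (allTables n n) ≡ count Q? (allTables n n)
count-involution {n} g g-inv {Q = Q} P? Q? P⇒Q Q⇒P = begin
  count P? tables         ≡⟨ ↭-length (filter-↭ P? tables↭g[tables]) ⟩
  count P? (map g tables) ≡⟨ count-map P? g tables ⟩
  count (P? ∘ g) tables   ≡⟨ count-≐ (P? ∘ g) Q? (λ t p → subst Q (g-inv t) (P⇒Q (g t) p)) Q⇒P tables ⟩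
  count Q? tables         ∎
  where
  open ≡-Reasoning
  tables = allTables n n
  g-injective : ∀ {x y} → g x ≡ g y → x ≡ y
  g-injective {x} {y} e = trans (sym (g-inv x)) (trans (cong g e) (g-inv y))
  tables↭g[tables] : tables ↭ map g tables
  tables↭g[tables] = ∼bag⇒↭ (unique∧set⇒bag (allTables-unique n n) (Unique.map⁺ g-injective (allTables-unique n n))
    (λ {x} → mk⇔ (λ _ → subst (_∈ map g tables) (g-inv x) (∈-map⁺ g (∈-allTables (g x))))
                 (λ _ → ∈-allTables x)))

-- Transpositions outside a set X

module _ {n} (X : Pred (Fin n) Level.zero) where

  SameEdgesWithin : Table n → Table n → Set
  SameEdgesWithin m₁ m₂ = ∀ x → X x → X (lookup m₁ x) ⊎ X (lookup m₂ x) → lookup m₁ x ≡ lookup m₂ x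

  InvariantOutside : {A : Set} → (Table n → A) → Set
  InvariantOutside h = ∀ m j k → IsPM m → ¬ X j → ¬ X k → h (conjugate (swap j k) m) ≡ h m

  swap-preserves-¬X : ∀ {j k y} → ¬ X j → ¬ X k → ¬ X y → ¬ X (swap j k y)
  swap-preserves-¬X {j} {k} {y} ¬Xj ¬Xk ¬Xy with swapView j k y
  ... | at-i refl   rewrite swap-matchˡ y k = ¬Xk
  ... | at-j refl _ rewrite swap-matchʳ j y = ¬Xj
  ... | elsewhere p q rewrite swap-mismatch j k p q = ¬Xy

  swap-fixes-X : ∀ {j k y} → ¬ X j → ¬ X k → X y → swap j k y ≡ y
  swap-fixes-X ¬Xj ¬Xk Xy = swap-mismatch _ _ (λ e → ¬Xj (subst X e Xy)) (λ e → ¬Xk (subst X e Xy))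

module _ {n} {X : Pred (Fin n) Level.zero} (X? : Decidable X) where

  private
    disagreements : Table n → Table n → ℕ
    disagreements m₁ m₂ = count (λ i → ¬? (lookup m₁ i ≟ lookup m₂ i)) (allFin n)

    outsideDisagreement : ∀ {m₁ m₂} → IsPM m₁ → IsPM m₂ → SameEdgesWithin X m₁ m₂ →
      ∀ i → lookup m₁ i ≢ lookup m₂ i →
      ∃ λ i′ → lookup m₁ i′ ≢ lookup m₂ i′ × ¬ X (lookup m₁ i′) × ¬ X (lookup m₂ i′)
    outsideDisagreement {m₁} {m₂} pm₁ pm₂ same i d with X? i | X? (lookup m₁ i) | X? (lookup m₂ i)
    ... | yes Xi | _ | _ = i , d , (λ x → d (same i Xi (inj₁ x))) , (λ x → d (same i Xi (inj₂ x)))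
    ... | no ¬Xi | yes Xj | _ = j , dj , (λ x → ¬Xi (subst X (proj₁ (pm₁ i)) x)) , (λ x → dj (same j Xj (inj₂ x)))
      where
      j = lookup m₁ i
      dj : lookup m₁ j ≢ lookup m₂ j
      dj e = d (sym (partner-sym m₂ pm₂ (trans (sym e) (proj₁ (pm₁ i)))))
    ... | no ¬Xi | no ¬Xj | yes Xk = k , dk , (λ x → dk (same k Xk (inj₁ x))) , (λ x → ¬Xi (subst X (proj₁ (pm₂ i)) x))
      where
      k = lookup m₂ i
      dk : lookup m₁ k ≢ lookup m₂ k
      dk e = d (partner-sym m₁ pm₁ (trans e (proj₁ (pm₂ i))))
    ... | no _ | no ¬Xj | no ¬Xk = i , d , ¬Xj , ¬Xk

    -- swapping the two partners of a disagreement i fixes it and creates no new one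
    module Repair {m₁ m₂ : Table n} (pm₁ : IsPM m₁) (pm₂ : IsPM m₂) (i : Fin n)
                  (d : lookup m₁ i ≢ lookup m₂ i) where
      j = lookup m₁ i
      k = lookup m₂ i
      m₁′ = conjugate (swap j k) m₁

      keeps-agreement : ∀ l → lookup m₁ l ≡ lookup m₂ l → lookup m₁′ l ≡ lookup m₂ l
      keeps-agreement l e = begin
        lookup m₁′ l                   ≡⟨ lookup-conjugate (swap j k) m₁ l ⟩
        swap j k (lookup m₁ (swap j k l)) ≡⟨ cong (swap j k ∘ lookup m₁) (swap-mismatch j k l≢j l≢k) ⟩
        swap j k (lookup m₁ l)         ≡⟨ cong (swap j k) e ⟩
        swap j k (lookup m₂ l)         ≡⟨ swap-mismatch j k m₂l≢j m₂l≢k ⟩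
        lookup m₂ l                    ∎
        where
        open ≡-Reasoning
        l≢i : l ≢ i
        l≢i refl = d e
        l≢j : l ≢ j
        l≢j refl = d (sym (partner-sym m₂ pm₂ (trans (sym e) (proj₁ (pm₁ i)))))
        l≢k : l ≢ k
        l≢k refl = d (partner-sym m₁ pm₁ (trans e (proj₁ (pm₂ i))))
        m₂l≢j : lookup m₂ l ≢ j
        m₂l≢j e′ = l≢i (partner-injective m₁ pm₁ (trans e e′))
        m₂l≢k : lookup m₂ l ≢ k
        m₂l≢k e′ = l≢i (partner-injective m₂ pm₂ e′)

      repairs : lookup m₁′ i ≡ lookup m₂ i
      repairs = trans (lookup-conjugate-swap-mismatch j k m₁ (≢-sym (proj₂ (pm₁ i))) (≢-sym (proj₂ (pm₂ i))))
                      (swap-matchˡ j k)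

      fewer : disagreements m₁′ m₂ < disagreements m₁ m₂
      fewer = count-< (λ l → ¬? (lookup m₁′ l ≟ lookup m₂ l)) (λ l → ¬? (lookup m₁ l ≟ lookup m₂ l))
                (λ l ne e → ne (keeps-agreement l e)) (allFin n) (∈-allFin i) d (λ ne → ne repairs)

      isPM : IsPM m₁′
      isPM = conjugate-isPM (swap j k) (swap-involutive j k) m₁ pm₁

      stays-same : ¬ X j → ¬ X k → SameEdgesWithin X m₁ m₂ → SameEdgesWithin X m₁′ m₂
      stays-same ¬Xj ¬Xk same x Xx X-partner with lookup m₁ x ≟ lookup m₂ x
      ... | yes e = keeps-agreement x e
      ... | no ne with X-partner
      ... | inj₂ X₂ = ⊥-elim (ne (same x Xx (inj₂ X₂)))
      ... | inj₁ X₁ = ⊥-elim (swap-preserves-¬X X ¬Xj ¬Xk ¬X₁′ (subst X (lookup-conjugate (swap j k) m₁ x) X₁))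
        where
        ¬X₁′ : ¬ X (lookup m₁ (swap j k x))
        ¬X₁′ rewrite swap-fixes-X X ¬Xj ¬Xk Xx = λ z → ne (same x Xx (inj₁ z))

  sameEdgesWithin⇒≡ : {A : Set} (h : Table n → A) → InvariantOutside X h →
    ∀ {m₁ m₂} → IsPM m₁ → IsPM m₂ → SameEdgesWithin X m₁ m₂ → h m₁ ≡ h m₂
  sameEdgesWithin⇒≡ h inv {m₁} {m₂} pm₁ pm₂ same = go (disagreements m₁ m₂) pm₁ same ℕ.≤-refl
    where
    go : ∀ bound {m} → IsPM m → SameEdgesWithin X m m₂ → disagreements m m₂ ≤ bound → h m ≡ h m₂
    go bound {m} pm same′ ≤bound with all? (λ i → lookup m i ≟ lookup m₂ i)
    ... | yes agree = cong h (lookup-ext agree)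
    ... | no ¬agree with ¬∀⟶∃¬ n _ (λ i → lookup m i ≟ lookup m₂ i) ¬agree
    ... | i₀ , d₀ with outsideDisagreement {m} {m₂} pm pm₂ same′ i₀ d₀
    ... | i , d , ¬Xj , ¬Xk with bound
    ... | zero = ⊥-elim (ℕ.<⇒≱ (count-pos (λ l → ¬? (lookup m l ≟ lookup m₂ l)) (∈-allFin i) d) ≤bound)
    ... | suc bound′ = trans (sym (inv m _ _ pm ¬Xj ¬Xk))
                             (go bound′ R.isPM (R.stays-same ¬Xj ¬Xk same′) (ℕ.≤-pred (ℕ.≤-trans R.fewer ≤bound)))
      where module R = Repair {m} {m₂} pm pm₂ i d

module _ {n : ℕ} where
  open import Data.List.Membership.DecPropositional (_≟_ {n = n}) using () renaming (_∈?_ to _∈?Fin_)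

  ∈-neighbours⁻ : ∀ {m t : Table n} → t ∈ neighbours m → IsPM t × Disjoint m t
  ∈-neighbours⁻ {m} t∈ with ∈-filter⁻ (disjoint? m) {xs = matchings n} t∈
  ... | t∈matchings , d = proj₂ (∈-filter⁻ isPM? {xs = allTables n n} t∈matchings) , d

  neighbours-isPM-disjoint : (m : Table n) → All (λ t → IsPM t × Disjoint m t) (neighbours m)
  neighbours-isPM-disjoint m = All.tabulate (∈-neighbours⁻ {m})

  partnerCount : Table n → Fin n → Fin n → ℕ
  partnerCount m x y = count (λ t → lookup t x ≟ y) (neighbours m)

  private
    partnerCount-allTables : ∀ m x y → partnerCount m x y ≡
      count (λ t → isPM? t ×-dec (disjoint? m t ×-dec (lookup t x ≟ y))) (allTables n n)
    partnerCount-allTables m x y =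
      trans (count-filter (λ t → lookup t x ≟ y) (disjoint? m) (matchings n))
            (count-filter (λ t → disjoint? m t ×-dec (lookup t x ≟ y)) isPM? (allTables n n))

    degree-allTables : ∀ m → degree m ≡ count (λ t → isPM? t ×-dec disjoint? m t) (allTables n n)
    degree-allTables m = count-filter (disjoint? m) isPM? (allTables n n)

  module _ (s : Fin n → Fin n) (inv : Involution s) where

    private
      conjugate-neighbour : ∀ m t → IsPM t × Disjoint m t → IsPM (conjugate s t) × Disjoint (conjugate s m) (conjugate s t)
      conjugate-neighbour m t (pm , d) = conjugate-isPM s inv t pm , conjugate-disjoint s inv m t d

      unconjugate-neighbour : ∀ m t → IsPM t × Disjoint (conjugate s m) t → IsPM (conjugate s t) × Disjoint m (conjugate s t)
      unconjugate-neighbour m t nb with conjugate-neighbour (conjugate s m) t nb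
      ... | pm , d rewrite conjugate-involutive s inv m = pm , d

    degree-conjugate : ∀ m → degree (conjugate s m) ≡ degree m
    degree-conjugate m = begin
      degree (conjugate s m) ≡⟨ degree-allTables (conjugate s m) ⟩
      count _ (allTables n n) ≡⟨ count-involution (conjugate s) (conjugate-involutive s inv) _ _
                                   (unconjugate-neighbour m) (conjugate-neighbour m) ⟩
      count _ (allTables n n) ≡⟨ degree-allTables m ⟨
      degree m               ∎
      where open ≡-Reasoning

    partnerCount-conjugate : ∀ m x y → partnerCount (conjugate s m) (s x) (s y) ≡ partnerCount m x y
    partnerCount-conjugate m x y = begin
      partnerCount (conjugate s m) (s x) (s y) ≡⟨ partnerCount-allTables (conjugate s m) (s x) (s y) ⟩
      count _ (allTables n n)                ≡⟨ count-involution (conjugate s) (conjugate-involutive s inv) _ _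
                                                  to from ⟩
      count _ (allTables n n)                ≡⟨ partnerCount-allTables m x y ⟨
      partnerCount m x y                     ∎
      where
      open ≡-Reasoning
      to : ∀ t → IsPM t × Disjoint (conjugate s m) t × lookup t (s x) ≡ s y →
           IsPM (conjugate s t) × Disjoint m (conjugate s t) × lookup (conjugate s t) x ≡ y
      to t (pm , d , e) with unconjugate-neighbour m t (pm , d)
      ... | pm′ , d′ = pm′ , d′ , trans (lookup-conjugate s t x) (trans (cong s e) (inv y))
      from : ∀ t → IsPM t × Disjoint m t × lookup t x ≡ y →
             IsPM (conjugate s t) × Disjoint (conjugate s m) (conjugate s t) × lookup (conjugate s t) (s x) ≡ s y
      from t (pm , d , e) with conjugate-neighbour m t (pm , d)
      ... | pm′ , d′ = pm′ , d′ , trans (lookup-conjugate s t (s x)) (cong s (trans (cong (lookup t) (inv x)) e))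

  degree-constant : ∀ {m m′ : Table n} → IsPM m → IsPM m′ → degree m ≡ degree m′
  degree-constant {m} {m′} pm pm′ = sameEdgesWithin⇒≡ {X = λ _ → ⊥} (λ _ → no λ ()) degree
    (λ m j k _ _ _ → degree-conjugate (swap j k) (swap-involutive j k) m) {m} {m′} pm pm′ (λ _ ())

  partnerCount-edge : ∀ m x y → lookup m x ≡ y → partnerCount m x y ≡ 0
  partnerCount-edge m x y e = count-none (λ t → lookup t x ≟ y)
    (All.map (λ (_ , d) e′ → d x (trans e (sym e′))) (neighbours-isPM-disjoint m))

  -- By symmetry, partnerCount m x y is the same for all y ∉ {x, m x}: the
  -- transposition of two such values y, y′ moves m only away from x and y′.
  partnerCount-indep : ∀ m → IsPM m → ∀ x {y y′} → y ≢ x → y ≢ lookup m x → y′ ≢ x → y′ ≢ lookup m x →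
                       partnerCount m x y ≡ partnerCount m x y′
  partnerCount-indep m pm x {y} {y′} y≢x y≢mx y′≢x y′≢mx with y ≟ y′
  ... | yes refl = refl
  ... | no y≢y′ = begin
    partnerCount m x y                   ≡⟨ partnerCount-conjugate τ (swap-involutive y y′) m x y ⟨
    partnerCount (conjugate τ m) (τ x) (τ y) ≡⟨ cong₂ (partnerCount (conjugate τ m)) τx≡x (swap-matchˡ y y′) ⟩
    partnerCount (conjugate τ m) x y′   ≡⟨ sameEdgesWithin⇒≡ X? (λ m′ → partnerCount m′ x y′) invariant
                                            {conjugate τ m} {m} (conjugate-isPM τ (swap-involutive y y′) m pm) pm same ⟩
    partnerCount m x y′                  ∎
    where
    open ≡-Reasoning
    τ = swap y y′
    X : Pred (Fin n) Level.zero
    X z = z ≡ x ⊎ z ≡ y′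
    X? : Decidable X
    X? z = (z ≟ x) ⊎-dec (z ≟ y′)
    τx≡x : τ x ≡ x
    τx≡x = swap-mismatch y y′ (λ e → y≢x (sym e)) (λ e → y′≢x (sym e))
    invariant : InvariantOutside X (λ m′ → partnerCount m′ x y′)
    invariant m′ j k _ ¬Xj ¬Xk = trans
      (cong₂ (partnerCount (conjugate (swap j k) m′))
             (sym (swap-mismatch j k (λ e → ¬Xj (inj₁ (sym e))) (λ e → ¬Xk (inj₁ (sym e)))))
             (sym (swap-mismatch j k (λ e → ¬Xj (inj₂ (sym e))) (λ e → ¬Xk (inj₂ (sym e))))))
      (partnerCount-conjugate (swap j k) (swap-involutive j k) m′ x y′)
    τ-¬X : ∀ {z} → z ≢ x → z ≢ y → ¬ X (τ z)
    τ-¬X {z} z≢x z≢y with swapView y y′ z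
    ... | at-i z≡y = ⊥-elim (z≢y z≡y)
    ... | at-j refl _ rewrite swap-matchʳ y z = [ y≢x , y≢y′ ]
    ... | elsewhere p q rewrite swap-mismatch y y′ p q = [ z≢x , q ]
    mx-fixed : lookup (conjugate τ m) x ≡ lookup m x
    mx-fixed = trans (lookup-conjugate τ m x)
      (trans (cong (τ ∘ lookup m) τx≡x) (swap-mismatch y y′ (λ e → y≢mx (sym e)) (λ e → y′≢mx (sym e))))
    ¬X-τmy′ : ¬ X (lookup (conjugate τ m) y′)
    ¬X-τmy′ rewrite lookup-conjugate τ m y′ | swap-matchʳ y y′ =
      τ-¬X (λ e → y≢mx (sym (partner-sym m pm e))) (proj₂ (pm y))
    ¬X-my′ : ¬ X (lookup m y′)
    ¬X-my′ (inj₁ e) = y′≢mx (sym (partner-sym m pm e))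
    ¬X-my′ (inj₂ e) = proj₂ (pm y′) e
    same : SameEdgesWithin X (conjugate τ m) m
    same _ (inj₁ refl) _ = mx-fixed
    same _ (inj₂ refl) (inj₁ X₁) = ⊥-elim (¬X-τmy′ X₁)
    same _ (inj₂ refl) (inj₂ X₂) = ⊥-elim (¬X-my′ X₂)

  private
    count-∈ : {A : Set} (f : A → Fin n) (L : List A) {Y : List (Fin n)} → Unique Y → (N : ℕ) →
              (∀ {y} → y ∈ Y → count (λ t → f t ≟ y) L ≡ N) → count (λ t → f t ∈?Fin Y) L ≡ length Y ℕ.* N
    count-∈ f L {[]} _ N _ = count-none (λ t → f t ∈?Fin []) {L} (All.tabulate λ _ ())
    count-∈ f L {y ∷ Y} (y∉Y ∷ uY) N count≡N = begin
      count (λ t → f t ∈?Fin (y ∷ Y)) L                          ≡⟨ count-≐ _ _ to from L ⟩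
      count (λ t → (f t ≟ y) ⊎-dec (f t ∈?Fin Y)) L              ≡⟨ count-⊎ _ _ disjoint L ⟩
      count (λ t → f t ≟ y) L ℕ.+ count (λ t → f t ∈?Fin Y) L    ≡⟨ cong₂ ℕ._+_ (count≡N (here refl))
                                                                      (count-∈ f L uY N (count≡N ∘ there)) ⟩
      N ℕ.+ length Y ℕ.* N                                     ∎
      where
      open ≡-Reasoning
      to : ∀ t → f t ∈ (y ∷ Y) → (f t ≡ y) ⊎ (f t ∈ Y)
      to t (here p)  = inj₁ p
      to t (there p) = inj₂ p
      from : ∀ t → (f t ≡ y) ⊎ (f t ∈ Y) → f t ∈ (y ∷ Y)
      from t = [ here , there ]
      disjoint : ∀ t → f t ≡ y → f t ∈ Y → ⊥
      disjoint t refl f∈Y = All.lookup y∉Y f∈Y refl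

    Avoids : Fin n → Fin n → Fin n → Set
    Avoids x x′ z = z ≢ x × z ≢ x′

    avoids? : ∀ x x′ → Decidable (Avoids x x′)
    avoids? x x′ z = ¬? (z ≟ x) ×-dec ¬? (z ≟ x′)

    count-avoids : ∀ {x x′} → x ≢ x′ → count (avoids? x x′) (allFin n) ≡ n ℕ.∸ 2
    count-avoids {x} {x′} x≢x′ = begin
      count A (allFin n)                                  ≡⟨ ℕ.m+n∸n≡m _ 2 ⟨
      count A (allFin n) ℕ.+ 2 ℕ.∸ 2                      ≡⟨ cong (λ c → count A (allFin n) ℕ.+ c ℕ.∸ 2) two ⟨
      count A (allFin n) ℕ.+ count (¬? ∘ A) (allFin n) ℕ.∸ 2 ≡⟨ cong (ℕ._∸ 2) (count+count-¬ A (allFin n)) ⟩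
      length (allFin n) ℕ.∸ 2                             ≡⟨ cong (ℕ._∸ 2) (length-tabulate {n = n} (λ i → i)) ⟩
      n ℕ.∸ 2                                             ∎
      where
      open ≡-Reasoning
      A = avoids? x x′
      to : ∀ z → ¬ Avoids x x′ z → z ≡ x ⊎ z ≡ x′
      to z ¬avoid with z ≟ x | z ≟ x′
      ... | yes e | _     = inj₁ e
      ... | no _  | yes e = inj₂ e
      ... | no p  | no q  = ⊥-elim (¬avoid (p , q))
      from : ∀ z → z ≡ x ⊎ z ≡ x′ → ¬ Avoids x x′ z
      from z (inj₁ e) (p , _) = p e
      from z (inj₂ e) (_ , q) = q e
      two : count (¬? ∘ A) (allFin n) ≡ 2
      two = begin
        count (¬? ∘ A) (allFin n)                            ≡⟨ count-≐ _ _ to from (allFin n) ⟩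
        count (λ z → (z ≟ x) ⊎-dec (z ≟ x′)) (allFin n)      ≡⟨ count-⊎ _ _ (λ _ e e′ → x≢x′ (trans (sym e) e′)) (allFin n) ⟩
        count (_≟ x) (allFin n) ℕ.+ count (_≟ x′) (allFin n) ≡⟨ cong₂ ℕ._+_ (count-≟ unique (∈-allFin x))
                                                                             (count-≟ unique (∈-allFin x′)) ⟩
        2                                                    ∎
        where unique = Unique.allFin⁺ n

  -- every neighbour matches x with one of the n - 2 vertices y ∉ {x, m x}
  degree≡ : ∀ {m} → IsPM m → ∀ x {y} → y ≢ x → y ≢ lookup m x → degree m ≡ (n ℕ.∸ 2) ℕ.* partnerCount m x y
  degree≡ {m} pm x {y} y≢x y≢mx = begin
    degree m                                              ≡⟨ count-all (λ t → lookup t x ∈?Fin Y) every-partner-in-Y ⟨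
    count (λ t → lookup t x ∈?Fin Y) (neighbours m)       ≡⟨ count-∈ (λ t → lookup t x) (neighbours m)
                                                               (Unique.filter⁺ (avoids? x (lookup m x)) (Unique.allFin⁺ n))
                                                               (partnerCount m x y) same-count ⟩
    length Y ℕ.* partnerCount m x y                       ≡⟨ cong (ℕ._* partnerCount m x y)
                                                               (count-avoids (λ e → proj₂ (pm x) (sym e))) ⟩
    (n ℕ.∸ 2) ℕ.* partnerCount m x y                      ∎
    where
    open ≡-Reasoning
    Y = filter (avoids? x (lookup m x)) (allFin n)
    every-partner-in-Y : All (λ t → lookup t x ∈ Y) (neighbours m)
    every-partner-in-Y = All.map (λ {t} (pmt , d) → ∈-filter⁺ (avoids? x (lookup m x)) (∈-allFin (lookup t x))
                                                      (proj₂ (pmt x) , (λ e → d x (sym e))))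
                                 (neighbours-isPM-disjoint m)
    same-count : ∀ {y′} → y′ ∈ Y → partnerCount m x y′ ≡ partnerCount m x y
    same-count y′∈Y with ∈-filter⁻ (avoids? x (lookup m x)) {xs = allFin n} y′∈Y
    ... | _ , y′≢x , y′≢mx = partnerCount-indep m pm x y′≢x y′≢mx y≢x y≢mx

toℚ : ℕ → ℚ
toℚ k = + k / 1

toℚ-suc : ∀ k → toℚ (suc k) ≡ 1ℚ + toℚ k
toℚ-suc k = toℚᵘ-injective (ℚᵘ.≃-trans (toℚᵘ-fromℚᵘ (mkℚᵘ (+ suc k) 0))
  (ℚᵘ.≃-sym (ℚᵘ.≃-trans (toℚᵘ-homo-+ 1ℚ (toℚ k))
     (ℚᵘ.≃-trans (ℚᵘ.+-congʳ (toℚᵘ 1ℚ) (toℚᵘ-fromℚᵘ (mkℚᵘ (+ k) 0)))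
        (*≡* (ℤ-identity (+ k)))))))
  where
  import Data.Integer.Solver as ℤ-Solver
  open ℤ-Solver.+-*-Solver using () renaming (solve to ℤ-solve; _:+_ to _:+ℤ_; _:*_ to _:*ℤ_; _:=_ to _:=ℤ_; con to conℤ)
  ℤ-identity : ∀ K → (+ 1 ℤ.* + 1 ℤ.+ K ℤ.* + 1) ℤ.* + 1 ≡ (+ 1 ℤ.+ K) ℤ.* (+ 1 ℤ.* + 1)
  ℤ-identity = ℤ-solve 1 (λ K → (conℤ (+ 1) :*ℤ conℤ (+ 1) :+ℤ K :*ℤ conℤ (+ 1)) :*ℤ conℤ (+ 1)
                              :=ℤ (conℤ (+ 1) :+ℤ K) :*ℤ (conℤ (+ 1) :*ℤ conℤ (+ 1))) refl

/-cancelʳ : ∀ p N .{{_ : ℕ.NonZero p}} → (+ (p ℕ.* N)) / p ≡ toℚ N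
/-cancelʳ (suc p) N = fromℚᵘ-cong {mkℚᵘ (+ (suc p ℕ.* N)) p} {mkℚᵘ (+ N) 0}
  (*≡* (trans (ℤ.*-identityʳ (+ (suc p ℕ.* N))) (trans (cong +_ (ℕ.*-comm (suc p) N)) (ℤ.pos-* N (suc p)))))

module _ {A : Set} where

  sum-cong : {f g : A → ℚ} (L : List A) → All (λ x → f x ≡ g x) L → sumℚ (map f L) ≡ sumℚ (map g L)
  sum-cong [] [] = refl
  sum-cong (x ∷ L) (e ∷ es) = cong₂ _+_ e (sum-cong L es)

  sum-scale : (q : ℚ) (g : A → ℚ) (L : List A) → sumℚ (map (λ x → q * g x) L) ≡ q * sumℚ (map g L)
  sum-scale q g [] = solve 1 (λ q → con 0ℚ := q :* con 0ℚ) refl q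
  sum-scale q g (x ∷ L) rewrite sum-scale q g L =
    solve 3 (λ q a b → q :* a :+ q :* b := q :* (a :+ b)) refl q (g x) (sumℚ (map g L))

  sum-+ : (f g : A → ℚ) (L : List A) → sumℚ (map (λ x → f x + g x) L) ≡ sumℚ (map f L) + sumℚ (map g L)
  sum-+ f g [] = refl
  sum-+ f g (x ∷ L) rewrite sum-+ f g L =
    solve 4 (λ a b c d → (a :+ b) :+ (c :+ d) := (a :+ c) :+ (b :+ d)) refl (f x) (g x) (sumℚ (map f L)) (sumℚ (map g L))

  sum-neg : (g : A → ℚ) (L : List A) → sumℚ (map (λ x → - g x) L) ≡ - sumℚ (map g L)
  sum-neg g [] = refl
  sum-neg g (x ∷ L) rewrite sum-neg g L = solve 2 (λ a b → :- a :+ :- b := :- (a :+ b)) refl (g x) (sumℚ (map g L))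

  sum-alternating : (f g h k : A → ℚ) (L : List A) →
    sumℚ (map (λ x → ((f x + - g x) + - h x) + k x) L)
      ≡ ((sumℚ (map f L) + - sumℚ (map g L)) + - sumℚ (map h L)) + sumℚ (map k L)
  sum-alternating f g h k L =
    trans (sum-+ (λ x → (f x + - g x) + - h x) k L)
      (cong (_+ sumℚ (map k L)) (trans (sum-+ (λ x → f x + - g x) (λ x → - h x) L)
        (cong₂ _+_ (trans (sum-+ f (λ x → - g x) L) (cong (λ z → sumℚ (map f L) + z) (sum-neg g L)))
                   (sum-neg h L))))

  sum-const : (c : ℚ) (L : List A) → sumℚ (map (λ _ → c) L) ≡ toℚ (length L) * c
  sum-const c [] = solve 1 (λ c → con 0ℚ := con 0ℚ :* c) refl c
  sum-const c (x ∷ L) rewrite sum-const c L | toℚ-suc (length L) =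
    solve 2 (λ c l → c :+ l :* c := (con 1ℚ :+ l) :* c) refl c (toℚ (length L))

≡-neg⇒≡0 : {x : ℚ} → x ≡ - x → x ≡ 0ℚ
≡-neg⇒≡0 {x} e = begin
  x             ≡⟨ solve 1 (λ x → x := con ½ :* (x :+ x)) refl x ⟩
  ½ * (x + x)   ≡⟨ cong (λ y → ½ * (x + y)) e ⟩
  ½ * (x + - x) ≡⟨ solve 1 (λ x → con ½ :* (x :+ :- x) := con 0ℚ) refl x ⟩
  0ℚ            ∎
  where open ≡-Reasoning

≡-neg⇒≡½ : {x : ℚ} (b : ℚ) → x ≡ b + - x → x ≡ ½ * b
≡-neg⇒≡½ {x} b e = begin
  x                   ≡⟨ solve 1 (λ x → x := con ½ :* (x :+ x)) refl x ⟩
  ½ * (x + x)         ≡⟨ cong (λ y → ½ * (x + y)) e ⟩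
  ½ * (x + (b + - x)) ≡⟨ solve 2 (λ x b → con ½ :* (x :+ (b :+ :- x)) := con ½ :* b) refl x b ⟩
  ½ * b               ∎
  where open ≡-Reasoning

neg-swap : {x y : ℚ} → x ≡ - y → y ≡ - x
neg-swap {x} {y} e = trans (solve 1 (λ y → y := :- (:- y)) refl y) (cong -_ (sym e))

𝟙 : {P : Set} → Dec P → ℚ
𝟙 (yes _) = 1ℚ
𝟙 (no _)  = 0ℚ

𝟙-yes : {P : Set} (P? : Dec P) → P → 𝟙 P? ≡ 1ℚ
𝟙-yes (yes _) _ = refl
𝟙-yes (no ¬p) p = ⊥-elim (¬p p)

𝟙-no : {P : Set} (P? : Dec P) → ¬ P → 𝟙 P? ≡ 0ℚ
𝟙-no (yes p) ¬p = ⊥-elim (¬p p)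
𝟙-no (no _)  _  = refl

sum-𝟙 : {A : Set} {P : Pred A Level.zero} (P? : Decidable P) (L : List A) →
        sumℚ (map (𝟙 ∘ P?) L) ≡ toℚ (count P? L)
sum-𝟙 P? [] = refl
sum-𝟙 P? (x ∷ L) with P? x
... | yes _ = trans (cong (λ z → 1ℚ + z) (sum-𝟙 P? L)) (sym (toℚ-suc (count P? L)))
... | no _  = trans (solve 1 (λ a → con 0ℚ :+ a := a) refl _) (sum-𝟙 P? L)

⋆V-transpose : (j k : Fin n) (f : Vtx n) (m : Table n) → (transpose j k ⋆V f) m ≡ f (conjugate (swap j k) m)
⋆V-transpose j k f m = cong f (tabulate-cong λ i → swap-comm j k (lookup m (swap j k i)))

-- the subset τ·s, written so that (transpose j k ⋆T u) s ≡ u (permute (swap j k) s) holds by definition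
permute : (Fin n → Fin n) → Subset n → Subset n
permute τ s = tabulate (λ i → lookup s (τ i))

permute-involutive : {τ : Fin n → Fin n} → Involution τ → (s : Subset n) → permute τ (permute τ s) ≡ s
permute-involutive {τ = τ} inv s = lookup-ext λ i →
  trans (lookup∘tabulate _ i) (trans (lookup∘tabulate _ (τ i)) (cong (lookup s) (inv i)))

indicator-permute : {τ : Fin n → Fin n} → Involution τ → (t s : Subset n) →
                    indicator t (permute τ s) ≡ indicator (permute τ t) s
indicator-permute {τ = τ} inv t s with ≡-dec Bool._≟_ (permute τ s) t | ≡-dec Bool._≟_ s (permute τ t)
... | yes _  | yes _  = refl
... | no _   | no _   = refl
... | yes e  | no ¬e  = ⊥-elim (¬e (trans (sym (permute-involutive inv s)) (cong (permute τ) e)))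
... | no ¬e  | yes e  = ⊥-elim (¬e (trans (cong (permute τ) e) (permute-involutive inv t)))

lookup-⁅⁆ : (x i : Fin n) → lookup ⁅ x ⁆ i ≡ does (i ≟ x)
lookup-⁅⁆ zero    zero    = refl
lookup-⁅⁆ zero    (suc i) = lookup-replicate i false
lookup-⁅⁆ (suc x) zero    = refl
lookup-⁅⁆ (suc x) (suc i) = lookup-⁅⁆ x i

lookup-pair : (x y i : Fin n) → lookup (pair x y) i ≡ does (i ≟ x) ∨ does (i ≟ y)
lookup-pair x y i = trans (lookup-zipWith _∨_ i ⁅ x ⁆ ⁅ y ⁆) (cong₂ _∨_ (lookup-⁅⁆ x i) (lookup-⁅⁆ y i))

does-≡ : {A B : Set} (A? : Dec A) (B? : Dec B) → (A → B) → (B → A) → does A? ≡ does B?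
does-≡ (yes _) (yes _) _ _ = refl
does-≡ (no _)  (no _)  _ _ = refl
does-≡ (yes a) (no ¬b) f _ = ⊥-elim (¬b (f a))
does-≡ (no ¬a) (yes b) _ g = ⊥-elim (¬a (g b))

permute-pair : {τ : Fin n → Fin n} → Involution τ → (x y : Fin n) → permute τ (pair x y) ≡ pair (τ x) (τ y)
permute-pair {τ = τ} inv x y = lookup-ext λ i → begin
  lookup (permute τ (pair x y)) i        ≡⟨ lookup∘tabulate _ i ⟩
  lookup (pair x y) (τ i)                ≡⟨ lookup-pair x y (τ i) ⟩
  does (τ i ≟ x) ∨ does (τ i ≟ y)        ≡⟨ cong₂ _∨_ (moves x) (moves y) ⟩
  does (i ≟ τ x) ∨ does (i ≟ τ y)        ≡⟨ lookup-pair (τ x) (τ y) i ⟨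
  lookup (pair (τ x) (τ y)) i            ∎
  where
  open ≡-Reasoning
  moves : ∀ {i} z → does (τ i ≟ z) ≡ does (i ≟ τ z)
  moves {i} z = does-≡ (τ i ≟ z) (i ≟ τ z) (λ e → trans (sym (inv i)) (cong τ e)) (λ e → trans (cong τ e) (inv z))

polytabloid-permute : {τ : Fin n → Fin n} → Involution τ → (a b c d : Fin n) (s : Subset n) →
  polytabloid a b c d (permute τ s) ≡ polytabloid (τ a) (τ b) (τ c) (τ d) s
polytabloid-permute {τ = τ} inv a b c d s =
  cong₂ _+_ (cong₂ _+_ (cong₂ _+_ (moved c d) (cong -_ (moved a d))) (cong -_ (moved c b))) (moved a b)
  where
  moved : ∀ x y → indicator (pair x y) (permute τ s) ≡ indicator (pair (τ x) (τ y)) s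
  moved x y = trans (indicator-permute inv (pair x y) s) (cong (λ t → indicator t s) (permute-pair inv x y))

distinct4-involution : {τ : Fin n → Fin n} → Involution τ → {a b c d : Fin n} →
                       Distinct4 a b c d → Distinct4 (τ a) (τ b) (τ c) (τ d)
distinct4-involution {τ = τ} inv (p₁ , p₂ , p₃ , p₄ , p₅ , p₆) =
  p₁ ∘ inj , p₂ ∘ inj , p₃ ∘ inj , p₄ ∘ inj , p₅ ∘ inj , p₆ ∘ inj
  where
  inj : ∀ {x y} → τ x ≡ τ y → x ≡ y
  inj = involution-injective τ inv

-- Relations between the images of polytabloids under an embedding of the Specht module

module Images {n} {F : Tab n → Vtx n} (emb : IsEmbedding (spechtRep n) F) where
  open IsEmbedding emb

  private variable
    a b c d x : Fin n
    m : Table n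

  single-∈ : Distinct4 a b c d → {u : Tab n} (q : ℚ) → (∀ s → u s ≡ q * polytabloid a b c d s) → InSpecht u
  single-∈ {a} {b} {c} {d} dd q e = ((q , a , b , c , d) ∷ []) , (dd ∷ []) , λ s _ → trans (e s) (sym (+-identityʳ _))

  polytabloid-∈ : Distinct4 a b c d → InSpecht (polytabloid a b c d)
  polytabloid-∈ dd = single-∈ dd 1ℚ (λ s → sym (*-identityˡ _))

  ψ : Fin n → Fin n → Fin n → Fin n → Vtx n
  ψ a b c d = F (polytabloid a b c d)

  ψ-transpose : Distinct4 a b c d → ∀ j k {a′ b′ c′ d′} →
    swap j k a ≡ a′ → swap j k b ≡ b′ → swap j k c ≡ c′ → swap j k d ≡ d′ → IsPM m →
    ψ a′ b′ c′ d′ m ≡ ψ a b c d (conjugate (swap j k) m)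
  ψ-transpose {a} {b} {c} {d} {m} dd j k refl refl refl refl pm = begin
    ψ (swap j k a) (swap j k b) (swap j k c) (swap j k d) m ≡⟨ resp (polytabloid-∈ dd′) moved-∈ moved m pm ⟩
    F (transpose j k ⋆T polytabloid a b c d) m          ≡⟨ equiv (transpose j k) (polytabloid-∈ dd) m pm ⟩
    (transpose j k ⋆V ψ a b c d) m                      ≡⟨ ⋆V-transpose j k (ψ a b c d) m ⟩
    ψ a b c d (conjugate (swap j k) m)                  ∎
    where
    open ≡-Reasoning
    dd′ = distinct4-involution (swap-involutive j k) dd
    moved-∈ : InSpecht (transpose j k ⋆T polytabloid a b c d)
    moved-∈ = single-∈ dd′ 1ℚ (λ s → trans (polytabloid-permute (swap-involutive j k) a b c d s) (sym (*-identityˡ _)))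
    moved : polytabloid _ _ _ _ ≈T (transpose j k ⋆T polytabloid a b c d)
    moved s _ = sym (polytabloid-permute (swap-involutive j k) a b c d s)

  private
    ψ-negate : Distinct4 a b c d → {u : Tab n} → (∀ s → u s ≡ - 1ℚ * polytabloid a b c d s) →
               InSpecht u → IsPM m → F u m ≡ - ψ a b c d m
    ψ-negate dd e u-∈ pm = trans (resp u-∈ (single-∈ dd (- 1ℚ) (λ _ → refl)) (λ s _ → e s) _ pm)
      (trans (scal (- 1ℚ) (polytabloid-∈ dd) _ pm) (solve 1 (λ v → :- con 1ℚ :* v := :- v) refl _))

  ψ-swap-ac : Distinct4 a b c d → IsPM m → ψ c b a d m ≡ - ψ a b c d m
  ψ-swap-ac {a} {b} {c} {d} dd pm = ψ-negate dd column-swap (single-∈ dd (- 1ℚ) column-swap) pm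
    where
    column-swap : ∀ s → polytabloid c b a d s ≡ - 1ℚ * polytabloid a b c d s
    column-swap s = solve 4 (λ cd ad cb ab → ((ad :+ :- cd) :+ :- ab) :+ cb := :- con 1ℚ :* (((cd :+ :- ad) :+ :- cb) :+ ab))
      refl (indicator (pair c d) s) (indicator (pair a d) s) (indicator (pair c b) s) (indicator (pair a b) s)

  ψ-swap-bd : Distinct4 a b c d → IsPM m → ψ a d c b m ≡ - ψ a b c d m
  ψ-swap-bd {a} {b} {c} {d} dd pm = ψ-negate dd column-swap (single-∈ dd (- 1ℚ) column-swap) pm
    where
    column-swap : ∀ s → polytabloid a d c b s ≡ - 1ℚ * polytabloid a b c d s
    column-swap s = solve 4 (λ cd ad cb ab → ((cb :+ :- ab) :+ :- cd) :+ ad := :- con 1ℚ :* (((cd :+ :- ad) :+ :- cb) :+ ab))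
      refl (indicator (pair c d) s) (indicator (pair a d) s) (indicator (pair c b) s) (indicator (pair a b) s)

  -- Garnir relation e(a b / c d) = e(a b / c x) + e(a x / c d), tableaux written row by row
  ψ-garnir : Distinct4 a b c d → Distinct4 a b c x → Distinct4 a x c d → IsPM m →
             ψ a b c d m ≡ ψ a b c x m + ψ a x c d m
  ψ-garnir {a} {b} {c} {d} {x} {m} dd₁ dd₂ dd₃ pm =
    trans (resp (polytabloid-∈ dd₁) sum-∈ (λ s _ → garnir s) m pm)
          (add (polytabloid-∈ dd₂) (polytabloid-∈ dd₃) m pm)
    where
    garnir : ∀ s → polytabloid a b c d s ≡ polytabloid a b c x s + polytabloid a x c d s
    garnir s = solve 6 (λ cd ad cb ab cx ax →
        ((cd :+ :- ad) :+ :- cb) :+ ab := (((cx :+ :- ax) :+ :- cb) :+ ab) :+ (((cd :+ :- ad) :+ :- cx) :+ ax))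
      refl (indicator (pair c d) s) (indicator (pair a d) s) (indicator (pair c b) s) (indicator (pair a b) s)
           (indicator (pair c x) s) (indicator (pair a x) s)
    sum-∈ : InSpecht (λ s → polytabloid a b c x s + polytabloid a x c d s)
    sum-∈ = ((1ℚ , a , b , c , x) ∷ (1ℚ , a , x , c , d) ∷ []) , (dd₂ ∷ dd₃ ∷ []) , λ s _ →
      solve 2 (λ p q → p :+ q := con 1ℚ :* p :+ (con 1ℚ :* q :+ con 0ℚ)) refl (polytabloid a b c x s) (polytabloid a x c d s)

-- The image of one polytabloid, evaluated on all matchings

-- E_T for the tableau T with columns (a, c) and (b, d)
columnPattern : Fin n → Fin n → Fin n → Fin n → Vtx n
columnPattern a b c d m = ((𝟙 (lookup m c ≟ d) + - 𝟙 (lookup m a ≟ d)) + - 𝟙 (lookup m c ≟ b)) + 𝟙 (lookup m a ≟ b)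

module OnePolytabloid {n} {F : Tab n → Vtx n} (emb : IsEmbedding (spechtRep n) F)
             {a b c d : Fin n} (dd : Distinct4 a b c d) where
  open Images emb

  private
    a≢b = proj₁ dd
    a≢c = proj₁ (proj₂ dd)
    a≢d = proj₁ (proj₂ (proj₂ dd))
    b≢c = proj₁ (proj₂ (proj₂ (proj₂ dd)))
    b≢d = proj₁ (proj₂ (proj₂ (proj₂ (proj₂ dd))))
    c≢d = proj₂ (proj₂ (proj₂ (proj₂ (proj₂ dd))))

  f : Vtx n
  f = ψ a b c d

  X : Pred (Fin n) Level.zero
  X z = z ≡ a ⊎ z ≡ b ⊎ z ≡ c ⊎ z ≡ d

  X? : Decidable X
  X? z = (z ≟ a) ⊎-dec (z ≟ b) ⊎-dec (z ≟ c) ⊎-dec (z ≟ d)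

  Outside : Table n → Fin n → Set
  Outside m z = ¬ X (lookup m z)

  module _ {z : Fin n} (¬Xz : ¬ X z) where
    ¬X⇒≢a : z ≢ a
    ¬X⇒≢a = ¬Xz ∘ inj₁
    ¬X⇒≢b : z ≢ b
    ¬X⇒≢b = ¬Xz ∘ inj₂ ∘ inj₁
    ¬X⇒≢c : z ≢ c
    ¬X⇒≢c = ¬Xz ∘ inj₂ ∘ inj₂ ∘ inj₁
    ¬X⇒≢d : z ≢ d
    ¬X⇒≢d = ¬Xz ∘ inj₂ ∘ inj₂ ∘ inj₂

  ≢⇒¬X : ∀ {z} → z ≢ a → z ≢ b → z ≢ c → z ≢ d → ¬ X z
  ≢⇒¬X p q r s = [ p , [ q , [ r , s ] ] ]

  swap-fixes-¬X : ∀ {j k z} → X j → X k → ¬ X z → swap j k z ≡ z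
  swap-fixes-¬X Xj Xk ¬Xz = swap-mismatch _ _ (λ e → ¬Xz (subst X (sym e) Xj)) (λ e → ¬Xz (subst X (sym e) Xk))

  ¬X-≡ : ∀ {y y′} → y′ ≡ y → ¬ X y → ¬ X y′
  ¬X-≡ e ¬Xy = ¬Xy ∘ subst X e

  private
    σ = swap a c
    ρ = swap b d
    σ-fixes : ∀ {z} → ¬ X z → σ z ≡ z
    σ-fixes = swap-fixes-¬X (inj₁ refl) (inj₂ (inj₂ (inj₁ refl)))
    ρ-fixes : ∀ {z} → ¬ X z → ρ z ≡ z
    ρ-fixes = swap-fixes-¬X (inj₂ (inj₁ refl)) (inj₂ (inj₂ (inj₂ refl)))
    σ-isPM : ∀ {m} → IsPM m → IsPM (conjugate σ m)
    σ-isPM {m} = conjugate-isPM σ (swap-involutive a c) m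
    ρ-isPM : ∀ {m} → IsPM m → IsPM (conjugate ρ m)
    ρ-isPM {m} = conjugate-isPM ρ (swap-involutive b d) m
    σb≡b : σ b ≡ b
    σb≡b = swap-mismatch a c (≢-sym a≢b) b≢c

  f-invariant : InvariantOutside X f
  f-invariant m j k pm ¬Xj ¬Xk = sym (ψ-transpose dd j k (fixed (inj₁ refl)) (fixed (inj₂ (inj₁ refl)))
                                       (fixed (inj₂ (inj₂ (inj₁ refl)))) (fixed (inj₂ (inj₂ (inj₂ refl)))) pm)
    where
    fixed : ∀ {z} → X z → swap j k z ≡ z
    fixed = swap-fixes-X X ¬Xj ¬Xk

  f-same : ∀ {m₁ m₂} → IsPM m₁ → IsPM m₂ → SameEdgesWithin X m₁ m₂ → f m₁ ≡ f m₂
  f-same = sameEdgesWithin⇒≡ X? f f-invariant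

  f-swap-ac : ∀ {m} → IsPM m → f (conjugate (swap a c) m) ≡ - f m
  f-swap-ac pm = trans (sym (ψ-transpose dd a c (swap-matchˡ a c) (swap-mismatch a c (≢-sym a≢b) b≢c)
                                                (swap-matchʳ a c) (swap-mismatch a c (≢-sym a≢d) (≢-sym c≢d)) pm))
                       (ψ-swap-ac dd pm)

  f-swap-bd : ∀ {m} → IsPM m → f (conjugate (swap b d) m) ≡ - f m
  f-swap-bd pm = trans (sym (ψ-transpose dd b d (swap-mismatch b d a≢b a≢d) (swap-matchˡ b d)
                                                (swap-mismatch b d (≢-sym b≢c) c≢d) (swap-matchʳ b d) pm))
                       (ψ-swap-bd dd pm)

  -- a matching containing an edge inside a column is fixed by the corresponding column swap
  f-edge-ac : ∀ {m} → IsPM m → lookup m a ≡ c → f m ≡ 0ℚ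
  f-edge-ac {m} pm e = ≡-neg⇒≡0 (trans (cong f (sym (conjugate-edge m pm e))) (f-swap-ac {m} pm))

  f-edge-bd : ∀ {m} → IsPM m → lookup m b ≡ d → f m ≡ 0ℚ
  f-edge-bd {m} pm e = ≡-neg⇒≡0 (trans (cong f (sym (conjugate-edge m pm e))) (f-swap-bd {m} pm))

  f-outside : ∀ {m} → IsPM m → Outside m a → Outside m b → Outside m c → Outside m d → f m ≡ 0ℚ
  f-outside {m} pm oa ob oc od = ≡-neg⇒≡0 (trans (sym (f-same (σ-isPM {m} pm) pm same))
                                                (f-swap-ac {m} pm))
    where
    m-outside : ∀ {z} → X z → Outside m z
    m-outside (inj₁ refl) = oa
    m-outside (inj₂ (inj₁ refl)) = ob
    m-outside (inj₂ (inj₂ (inj₁ refl))) = oc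
    m-outside (inj₂ (inj₂ (inj₂ refl))) = od
    σm-outside : ∀ {z} → X z → Outside (conjugate σ m) z
    σm-outside (inj₁ refl) = oc ∘ subst X (trans (lookup-conjugate-swapˡ a c m) (σ-fixes oc))
    σm-outside (inj₂ (inj₁ refl)) =
      ob ∘ subst X (trans (lookup-conjugate-swap-mismatch a c m (≢-sym a≢b) b≢c) (σ-fixes ob))
    σm-outside (inj₂ (inj₂ (inj₁ refl))) = oa ∘ subst X (trans (lookup-conjugate-swapʳ a c m) (σ-fixes oa))
    σm-outside (inj₂ (inj₂ (inj₂ refl))) =
      od ∘ subst X (trans (lookup-conjugate-swap-mismatch a c m (≢-sym a≢d) (≢-sym c≢d)) (σ-fixes od))
    same : SameEdgesWithin X (conjugate σ m) m
    same z Xz = ⊥-elim ∘ [ σm-outside Xz , m-outside Xz ]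

  f-agree : ∀ {m₁ m₂} → IsPM m₁ → IsPM m₂ → lookup m₁ a ≡ lookup m₂ a → lookup m₁ b ≡ lookup m₂ b →
            lookup m₁ c ≡ lookup m₂ c → lookup m₁ d ≡ lookup m₂ d → f m₁ ≡ f m₂
  f-agree {m₁} {m₂} pm₁ pm₂ ea eb ec ed = f-same pm₁ pm₂ same
    where
    same : SameEdgesWithin X m₁ m₂
    same _ (inj₁ refl) _ = ea
    same _ (inj₂ (inj₁ refl)) _ = eb
    same _ (inj₂ (inj₂ (inj₁ refl))) _ = ec
    same _ (inj₂ (inj₂ (inj₂ refl))) _ = ed

  data Position (m : Table n) : Set where
    ac-edge : lookup m a ≡ c → Position m
    bd-edge : lookup m b ≡ d → Position m
    ab-cd   : lookup m a ≡ b → lookup m c ≡ d → Position m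
    ad-cb   : lookup m a ≡ d → lookup m c ≡ b → Position m
    ab-only : lookup m a ≡ b → Outside m c → Outside m d → Position m
    cb-only : lookup m c ≡ b → Outside m a → Outside m d → Position m
    ad-only : lookup m a ≡ d → Outside m b → Outside m c → Position m
    cd-only : lookup m c ≡ d → Outside m a → Outside m b → Position m
    none    : Outside m a → Outside m b → Outside m c → Outside m d → Position m

  weight : ∀ {m} → Position m → ℚ
  weight (ac-edge _)     = 0ℚ
  weight (bd-edge _)     = 0ℚ
  weight (ab-cd _ _)     = 1ℚ + 1ℚ
  weight (ad-cb _ _)     = - (1ℚ + 1ℚ)
  weight (ab-only _ _ _) = 1ℚ
  weight (cb-only _ _ _) = - 1ℚ
  weight (ad-only _ _ _) = - 1ℚ
  weight (cd-only _ _ _) = 1ℚ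
  weight (none _ _ _ _)  = 0ℚ

  module _ {m : Table n} (pm : IsPM m) where
    private
      ps = partner-sym m pm
      yes′ : ∀ {x y} → lookup m x ≡ y → 𝟙 (lookup m x ≟ y) ≡ 1ℚ
      yes′ = 𝟙-yes (_ ≟ _)
      no′ : ∀ {x y} → lookup m x ≢ y → 𝟙 (lookup m x ≟ y) ≡ 0ℚ
      no′ = 𝟙-no (_ ≟ _)
      eval : ∀ {p q r s} → 𝟙 (lookup m c ≟ d) ≡ p → 𝟙 (lookup m a ≟ d) ≡ q → 𝟙 (lookup m c ≟ b) ≡ r →
               𝟙 (lookup m a ≟ b) ≡ s → columnPattern a b c d m ≡ ((p + - q) + - r) + s
      eval refl refl refl refl = refl

    outside-a : lookup m a ≢ b → lookup m a ≢ c → lookup m a ≢ d → Outside m a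
    outside-a = ≢⇒¬X (proj₂ (pm a))

    outside-b : lookup m a ≢ b → lookup m c ≢ b → lookup m b ≢ d → Outside m b
    outside-b ¬ab ¬cb ¬bd = ≢⇒¬X (¬ab ∘ ps) (proj₂ (pm b)) (¬cb ∘ ps) ¬bd

    outside-c : lookup m a ≢ c → lookup m c ≢ b → lookup m c ≢ d → Outside m c
    outside-c ¬ac ¬cb ¬cd = ≢⇒¬X (¬ac ∘ ps) ¬cb (proj₂ (pm c)) ¬cd

    outside-d : lookup m a ≢ d → lookup m b ≢ d → lookup m c ≢ d → Outside m d
    outside-d ¬ad ¬bd ¬cd = ≢⇒¬X (¬ad ∘ ps) (¬bd ∘ ps) (¬cd ∘ ps) (proj₂ (pm d))

    position : Position m
    position with lookup m a ≟ c | lookup m b ≟ d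
    ... | yes ac | _      = ac-edge ac
    ... | no _   | yes bd = bd-edge bd
    ... | no ¬ac | no ¬bd with lookup m a ≟ b | lookup m a ≟ d | lookup m c ≟ b | lookup m c ≟ d
    ... | yes ab | yes ad | _      | _      = ⊥-elim (b≢d (trans (sym ab) ad))
    ... | _      | _      | yes cb | yes cd = ⊥-elim (b≢d (trans (sym cb) cd))
    ... | yes ab | _      | yes cb | _      = ⊥-elim (a≢c (partner-injective m pm (trans ab (sym cb))))
    ... | _      | yes ad | _      | yes cd = ⊥-elim (a≢c (partner-injective m pm (trans ad (sym cd))))
    ... | yes ab | no _   | no _   | yes cd = ab-cd ab cd
    ... | no _   | yes ad | yes cb | no _   = ad-cb ad cb
    ... | yes ab | no ¬ad | no ¬cb | no ¬cd = ab-only ab (outside-c ¬ac ¬cb ¬cd) (outside-d ¬ad ¬bd ¬cd)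
    ... | no ¬ab | no ¬ad | yes cb | no ¬cd = cb-only cb (outside-a ¬ab ¬ac ¬ad) (outside-d ¬ad ¬bd ¬cd)
    ... | no ¬ab | yes ad | no ¬cb | no ¬cd = ad-only ad (outside-b ¬ab ¬cb ¬bd) (outside-c ¬ac ¬cb ¬cd)
    ... | no ¬ab | no ¬ad | no ¬cb | yes cd = cd-only cd (outside-a ¬ab ¬ac ¬ad) (outside-b ¬ab ¬cb ¬bd)
    ... | no ¬ab | no ¬ad | no ¬cb | no ¬cd =
      none (outside-a ¬ab ¬ac ¬ad) (outside-b ¬ab ¬cb ¬bd) (outside-c ¬ac ¬cb ¬cd) (outside-d ¬ad ¬bd ¬cd)

    columnPattern-position : (p : Position m) → columnPattern a b c d m ≡ weight p
    columnPattern-position (ac-edge ac) =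
      eval (no′ (a≢d ∘ trans (sym (ps ac)))) (no′ (c≢d ∘ trans (sym ac)))
           (no′ (a≢b ∘ trans (sym (ps ac)))) (no′ (≢-sym b≢c ∘ trans (sym ac)))
    columnPattern-position (bd-edge bd) =
      eval (no′ (b≢c ∘ trans (sym (ps bd)) ∘ ps)) (no′ (≢-sym a≢b ∘ trans (sym (ps bd)) ∘ ps))
           (no′ (≢-sym c≢d ∘ trans (sym bd) ∘ ps)) (no′ (≢-sym a≢d ∘ trans (sym bd) ∘ ps))
    columnPattern-position (ab-cd ab cd) =
      eval (yes′ cd) (no′ (b≢d ∘ trans (sym ab))) (no′ (≢-sym b≢d ∘ trans (sym cd))) (yes′ ab)
    columnPattern-position (ad-cb ad cb) =
      eval (no′ (b≢d ∘ trans (sym cb))) (yes′ ad) (yes′ cb) (no′ (≢-sym b≢d ∘ trans (sym ad)))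
    columnPattern-position (ab-only ab oc _) =
      eval (no′ (¬X⇒≢d oc)) (no′ (b≢d ∘ trans (sym ab))) (no′ (¬X⇒≢b oc)) (yes′ ab)
    columnPattern-position (cb-only cb oa _) =
      eval (no′ (b≢d ∘ trans (sym cb))) (no′ (¬X⇒≢d oa)) (yes′ cb) (no′ (¬X⇒≢b oa))
    columnPattern-position (ad-only ad _ oc) =
      eval (no′ (¬X⇒≢d oc)) (yes′ ad) (no′ (¬X⇒≢b oc)) (no′ (≢-sym b≢d ∘ trans (sym ad)))
    columnPattern-position (cd-only cd oa _) =
      eval (yes′ cd) (no′ (¬X⇒≢d oa)) (no′ (≢-sym b≢d ∘ trans (sym cd))) (no′ (¬X⇒≢b oa))
    columnPattern-position (none oa _ oc _) =
      eval (no′ (¬X⇒≢d oc)) (no′ (¬X⇒≢d oa)) (no′ (¬X⇒≢b oc)) (no′ (¬X⇒≢b oa))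

  module Reference {mβ : Table n} (pmβ : IsPM mβ) (βa : lookup mβ a ≡ b) (βc : lookup mβ c ≡ d) where

    β : ℚ
    β = f mβ

    f-ab-cd : ∀ {m} → IsPM m → lookup m a ≡ b → lookup m c ≡ d → f m ≡ β
    f-ab-cd {m} pm ea ec = f-agree pm pmβ (trans ea (sym βa)) (trans (partner-sym m pm ea) (sym (partner-sym mβ pmβ βa)))
                                          (trans ec (sym βc)) (trans (partner-sym m pm ec) (sym (partner-sym mβ pmβ βc)))

    f-ad-cb : ∀ {m} → IsPM m → lookup m a ≡ d → lookup m c ≡ b → f m ≡ - β
    f-ad-cb {m} pm ea ec = trans (neg-swap (f-swap-ac {m} pm)) (cong -_ (f-ab-cd (σ-isPM {m} pm)
      (trans (lookup-conjugate-swapˡ a c m) (trans (cong σ ec) σb≡b))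
      (trans (lookup-conjugate-swapʳ a c m) (trans (cong σ ea) (swap-mismatch a c (≢-sym a≢d) (≢-sym c≢d))))))

    -- the Garnir relation, with both summands brought back to f by transpositions
    f-ab : ∀ {m} → IsPM m → lookup m a ≡ b → Outside m c → Outside m d → f m ≡ ½ * β
    f-ab {m} pm ea oc od = ≡-neg⇒≡½ β (begin
      f m                       ≡⟨ ψ-garnir dd dd₂ dd₃ pm ⟩
      ψ a b c x m + ψ a x c d m ≡⟨ cong₂ _+_
                                     (ψ-transpose dd d x (swap-mismatch d x a≢d x≢a) (swap-mismatch d x b≢d x≢b)
                                                         (swap-mismatch d x c≢d x≢c) (swap-matchˡ d x) pm)
                                     (ψ-transpose dd b x (swap-mismatch b x a≢b x≢a) (swap-matchˡ b x)
                                                         (swap-mismatch b x (≢-sym b≢c) x≢c)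
                                                         (swap-mismatch b x (≢-sym b≢d) x≢d) pm) ⟩
      f m₁ + f m₂               ≡⟨ cong₂ _+_ (f-ab-cd pm₁ m₁a m₁c)
                                             (neg-swap (trans (sym f-m₃) (f-swap-ac {m₂} pm₂))) ⟩
      β + - f m                 ∎)
      where
      open ≡-Reasoning
      x = lookup m c
      x≢a : a ≢ x
      x≢a = ≢-sym (¬X⇒≢a oc)
      x≢b : b ≢ x
      x≢b = ≢-sym (¬X⇒≢b oc)
      x≢c : c ≢ x
      x≢c = ≢-sym (¬X⇒≢c oc)
      x≢d : d ≢ x
      x≢d = ≢-sym (¬X⇒≢d oc)
      dd₂ : Distinct4 a b c x
      dd₂ = a≢b , a≢c , x≢a , b≢c , x≢b , x≢c
      dd₃ : Distinct4 a x c d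
      dd₃ = x≢a , a≢c , a≢d , ≢-sym x≢c , ≢-sym x≢d , c≢d
      m₁ = conjugate (swap d x) m
      pm₁ = conjugate-isPM (swap d x) (swap-involutive d x) m pm
      m₁a : lookup m₁ a ≡ b
      m₁a = trans (lookup-conjugate-swap-mismatch d x m a≢d x≢a) (trans (cong (swap d x) ea) (swap-mismatch d x b≢d x≢b))
      m₁c : lookup m₁ c ≡ d
      m₁c = trans (lookup-conjugate-swap-mismatch d x m c≢d x≢c) (swap-matchʳ d x)
      m₂ = conjugate (swap b x) m
      pm₂ = conjugate-isPM (swap b x) (swap-involutive b x) m pm
      m₃ = conjugate σ m₂
      m₃a : lookup m₃ a ≡ lookup m a
      m₃a = begin
        lookup m₃ a              ≡⟨ lookup-conjugate-swapˡ a c m₂ ⟩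
        σ (lookup m₂ c)          ≡⟨ cong σ (lookup-conjugate-swap-mismatch b x m (≢-sym b≢c) x≢c) ⟩
        σ (swap b x x)           ≡⟨ cong σ (swap-matchʳ b x) ⟩
        σ b                      ≡⟨ trans σb≡b (sym ea) ⟩
        lookup m a               ∎
      m₃b : lookup m₃ b ≡ lookup m b
      m₃b = begin
        lookup m₃ b              ≡⟨ lookup-conjugate-swap-mismatch a c m₂ (≢-sym a≢b) b≢c ⟩
        σ (lookup m₂ b)          ≡⟨ cong σ (lookup-conjugate-swapˡ b x m) ⟩
        σ (swap b x (lookup m x)) ≡⟨ cong (σ ∘ swap b x) (partner-sym m pm refl) ⟩
        σ (swap b x c)           ≡⟨ cong σ (swap-mismatch b x (≢-sym b≢c) x≢c) ⟩
        σ c                      ≡⟨ swap-matchʳ a c ⟩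
        a                        ≡⟨ partner-sym m pm ea ⟨
        lookup m b               ∎
      m₃c : lookup m₃ c ≡ lookup m c
      m₃c = begin
        lookup m₃ c              ≡⟨ lookup-conjugate-swapʳ a c m₂ ⟩
        σ (lookup m₂ a)          ≡⟨ cong σ (lookup-conjugate-swap-mismatch b x m a≢b x≢a) ⟩
        σ (swap b x (lookup m a)) ≡⟨ cong (σ ∘ swap b x) ea ⟩
        σ (swap b x b)           ≡⟨ cong σ (swap-matchˡ b x) ⟩
        σ x                      ≡⟨ σ-fixes oc ⟩
        x                        ∎
      m₃d : lookup m₃ d ≡ lookup m d
      m₃d = begin
        lookup m₃ d              ≡⟨ lookup-conjugate-swap-mismatch a c m₂ (≢-sym a≢d) (≢-sym c≢d) ⟩
        σ (lookup m₂ d)          ≡⟨ cong σ (lookup-conjugate-swap-mismatch b x m (≢-sym b≢d) x≢d) ⟩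
        σ (swap b x (lookup m d)) ≡⟨ cong σ (swap-mismatch b x (¬X⇒≢b od) (≢-sym c≢d ∘ partner-injective m pm)) ⟩
        σ (lookup m d)           ≡⟨ σ-fixes od ⟩
        lookup m d               ∎
      f-m₃ : f m₃ ≡ f m
      f-m₃ = f-agree (σ-isPM {m₂} pm₂) pm m₃a m₃b m₃c m₃d

    f-cb : ∀ {m} → IsPM m → lookup m c ≡ b → Outside m a → Outside m d → f m ≡ - (½ * β)
    f-cb {m} pm ec oa od = trans (neg-swap (f-swap-ac {m} pm)) (cong -_ (f-ab (σ-isPM {m} pm)
      (trans (lookup-conjugate-swapˡ a c m) (trans (cong σ ec) σb≡b))
      (¬X-≡ (trans (lookup-conjugate-swapʳ a c m) (σ-fixes oa)) oa)
      (¬X-≡ (trans (lookup-conjugate-swap-mismatch a c m (≢-sym a≢d) (≢-sym c≢d)) (σ-fixes od)) od)))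

    f-ad : ∀ {m} → IsPM m → lookup m a ≡ d → Outside m b → Outside m c → f m ≡ - (½ * β)
    f-ad {m} pm ea ob oc = trans (neg-swap (f-swap-bd {m} pm)) (cong -_ (f-ab (ρ-isPM {m} pm)
      (trans (lookup-conjugate-swap-mismatch b d m a≢b a≢d) (trans (cong ρ ea) (swap-matchʳ b d)))
      (¬X-≡ (trans (lookup-conjugate-swap-mismatch b d m (≢-sym b≢c) c≢d) (ρ-fixes oc)) oc)
      (¬X-≡ (trans (lookup-conjugate-swapʳ b d m) (ρ-fixes ob)) ob)))

    f-cd : ∀ {m} → IsPM m → lookup m c ≡ d → Outside m a → Outside m b → f m ≡ ½ * β
    f-cd {m} pm ec oa ob = trans (neg-swap (f-swap-ac {m} pm)) (trans (cong -_ (f-ad (σ-isPM {m} pm)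
      (trans (lookup-conjugate-swapˡ a c m) (trans (cong σ ec) (swap-mismatch a c (≢-sym a≢d) (≢-sym c≢d))))
      (¬X-≡ (trans (lookup-conjugate-swap-mismatch a c m (≢-sym a≢b) b≢c) (σ-fixes ob)) ob)
      (¬X-≡ (trans (lookup-conjugate-swapʳ a c m) (σ-fixes oa)) oa)))
      (sym (neg-swap refl)))

    f-position : ∀ {m} → IsPM m → (p : Position m) → f m ≡ ½ * β * weight p
    f-position pm (ac-edge ac)       = trans (f-edge-ac pm ac) (solve 1 (λ β → con 0ℚ := con ½ :* β :* con 0ℚ) refl β)
    f-position pm (bd-edge bd)       = trans (f-edge-bd pm bd) (solve 1 (λ β → con 0ℚ := con ½ :* β :* con 0ℚ) refl β)
    f-position pm (ab-cd ab cd)      = trans (f-ab-cd pm ab cd)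
                                             (solve 1 (λ β → β := con ½ :* β :* (con 1ℚ :+ con 1ℚ)) refl β)
    f-position pm (ad-cb ad cb)      = trans (f-ad-cb pm ad cb)
                                             (solve 1 (λ β → :- β := con ½ :* β :* :- (con 1ℚ :+ con 1ℚ)) refl β)
    f-position pm (ab-only ab oc od) = trans (f-ab pm ab oc od) (solve 1 (λ β → con ½ :* β := con ½ :* β :* con 1ℚ) refl β)
    f-position pm (cb-only cb oa od) = trans (f-cb pm cb oa od)
                                             (solve 1 (λ β → :- (con ½ :* β) := con ½ :* β :* :- con 1ℚ) refl β)
    f-position pm (ad-only ad ob oc) = trans (f-ad pm ad ob oc)
                                             (solve 1 (λ β → :- (con ½ :* β) := con ½ :* β :* :- con 1ℚ) refl β)
    f-position pm (cd-only cd oa ob) = trans (f-cd pm cd oa ob) (solve 1 (λ β → con ½ :* β := con ½ :* β :* con 1ℚ) refl β)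
    f-position pm (none oa ob oc od) = trans (f-outside pm oa ob oc od)
                                             (solve 1 (λ β → con 0ℚ := con ½ :* β :* con 0ℚ) refl β)

    f≡columnPattern : ∀ {m} → IsPM m → f m ≡ ½ * β * columnPattern a b c d m
    f≡columnPattern {m} pm =
      trans (f-position pm (position pm)) (cong (½ * β *_) (sym (columnPattern-position {m} pm (position pm))))

module _ {n : ℕ} where

  IsEigenvector : ℚ → Vtx n → Set
  IsEigenvector ξ g = ∀ m → IsPM m → adj g m ≡ ξ * g m

  adj-cong : {g g′ : Vtx n} → g ≈V g′ → ∀ m → adj g m ≡ adj g′ m
  adj-cong g≈g′ m = sum-cong (neighbours m) (All.map (λ (pm , _) → g≈g′ _ pm) (neighbours-isPM-disjoint m))

  isEigenvector-cong : ∀ {ξ} {g g′ : Vtx n} → g ≈V g′ → IsEigenvector ξ g → IsEigenvector ξ g′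
  isEigenvector-cong {ξ} g≈g′ eig m pm = trans (sym (adj-cong g≈g′ m)) (trans (eig m pm) (cong (ξ *_) (g≈g′ m pm)))

  isEigenvector-0 : ∀ {ξ} → IsEigenvector ξ (λ _ → 0ℚ)
  isEigenvector-0 {ξ} m _ = trans (sum-const 0ℚ (neighbours m))
    (solve 2 (λ l ξ → l :* con 0ℚ := ξ :* con 0ℚ) refl (toℚ (length (neighbours m))) ξ)

  isEigenvector-· : ∀ {ξ} q {g : Vtx n} → IsEigenvector ξ g → IsEigenvector ξ (q ·V g)
  isEigenvector-· {ξ} q {g} eig m pm = begin
    adj (q ·V g) m  ≡⟨ sum-scale q g (neighbours m) ⟩
    q * adj g m     ≡⟨ cong (q *_) (eig m pm) ⟩
    q * (ξ * g m)   ≡⟨ solve 3 (λ q ξ u → q :* (ξ :* u) := ξ :* (q :* u)) refl q ξ (g m) ⟩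
    ξ * (q * g m)   ∎
    where open ≡-Reasoning

  isEigenvector-+ : ∀ {ξ} {g g′ : Vtx n} → IsEigenvector ξ g → IsEigenvector ξ g′ → IsEigenvector ξ (g +V g′)
  isEigenvector-+ {ξ} {g} {g′} eig eig′ m pm = begin
    adj (g +V g′) m          ≡⟨ sum-+ g g′ (neighbours m) ⟩
    adj g m + adj g′ m       ≡⟨ cong₂ _+_ (eig m pm) (eig′ m pm) ⟩
    ξ * g m + ξ * g′ m       ≡⟨ solve 3 (λ ξ u v → ξ :* u :+ ξ :* v := ξ :* (u :+ v)) refl ξ (g m) (g′ m) ⟩
    ξ * (g m + g′ m)         ∎
    where open ≡-Reasoning

trivial-isEigenvector : {m₀ : Table n} → IsPM m₀ → {F : ℚ → Vtx n} → IsEmbedding (trivialRep n) F →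
                        ∀ q → IsEigenvector (toℚ (degree m₀)) (F q)
trivial-isEigenvector {m₀ = m₀} pm₀ {F} emb q m pm = begin
  adj (F q) m                            ≡⟨ adj-cong (λ t pmt → constant {t} {m} pmt pm) m ⟩
  sumℚ (map (λ _ → F q m) (neighbours m)) ≡⟨ sum-const (F q m) (neighbours m) ⟩
  toℚ (degree m) * F q m                 ≡⟨ cong (λ k → toℚ k * F q m) (degree-constant {m = m} {m₀} pm pm₀) ⟩
  toℚ (degree m₀) * F q m                ∎
  where
  open ≡-Reasoning
  open IsEmbedding emb
  invariant : InvariantOutside (λ _ → ⊥) (F q)
  invariant m′ j k pm′ _ _ = sym (trans (equiv (transpose j k) _ m′ pm′) (⋆V-transpose j k (F q) m′))
  constant : ∀ {m₁ m₂} → IsPM m₁ → IsPM m₂ → F q m₁ ≡ F q m₂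
  constant {m₁} {m₂} pm₁ pm₂ = sameEdgesWithin⇒≡ (λ _ → no λ ()) (F q) invariant {m₁} {m₂} pm₁ pm₂ (λ _ ())

module Eigenvalue {n} {m₀ : Table n} (pm₀ : IsPM m₀) .{{_ : ℕ.NonZero (n ℕ.∸ 2)}} where

  N : ℚ
  N = + degree m₀ / (n ℕ.∸ 2)

  private
    partnerCount-ℚ : ∀ {m} → IsPM m → ∀ x {y} → y ≢ x → (mx≟y : Dec (lookup m x ≡ y)) →
                     toℚ (partnerCount m x y) ≡ N + - (N * 𝟙 mx≟y)
    partnerCount-ℚ {m} pm x {y} y≢x (yes mx≡y) =
      trans (cong toℚ (partnerCount-edge m x y mx≡y)) (solve 1 (λ N → con 0ℚ := N :+ :- (N :* con 1ℚ)) refl N)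
    partnerCount-ℚ {m} pm x {y} y≢x (no mx≢y) = begin
      toℚ (partnerCount m x y)                    ≡⟨ /-cancelʳ (n ℕ.∸ 2) (partnerCount m x y) ⟨
      + ((n ℕ.∸ 2) ℕ.* partnerCount m x y) / (n ℕ.∸ 2) ≡⟨ cong (λ k → + k / (n ℕ.∸ 2)) (sym degree-m₀) ⟩
      N                                           ≡⟨ solve 1 (λ N → N := N :+ :- (N :* con 0ℚ)) refl N ⟩
      N + - (N * 0ℚ)                              ∎
      where
      open ≡-Reasoning
      degree-m₀ : degree m₀ ≡ (n ℕ.∸ 2) ℕ.* partnerCount m x y
      degree-m₀ = trans (degree-constant {m = m₀} {m} pm₀ pm) (degree≡ {m = m} pm x y≢x (≢-sym mx≢y))

    sum-partner : ∀ m → IsPM m → ∀ x {y} → y ≢ x →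
      sumℚ (map (λ t → 𝟙 (lookup t x ≟ y)) (neighbours m)) ≡ N + - (N * 𝟙 (lookup m x ≟ y))
    sum-partner m pm x {y} y≢x =
      trans (sum-𝟙 (λ t → lookup t x ≟ y) (neighbours m)) (partnerCount-ℚ {m} pm x y≢x (lookup m x ≟ y))

    constant-parts-cancel : ∀ N p q r s →
      ((N + - (N * p) + - (N + - (N * q))) + - (N + - (N * r))) + (N + - (N * s)) ≡ - N * (((p + - q) + - r) + s)
    constant-parts-cancel = solve 5 (λ N p q r s →
      ((N :+ :- (N :* p) :+ :- (N :+ :- (N :* q))) :+ :- (N :+ :- (N :* r))) :+ (N :+ :- (N :* s))
        := :- N :* (((p :+ :- q) :+ :- r) :+ s)) refl

  columnPattern-isEigenvector : ∀ {a b c d} → Distinct4 a b c d → IsEigenvector (- N) (columnPattern a b c d)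
  columnPattern-isEigenvector {a} {b} {c} {d} (a≢b , a≢c , a≢d , b≢c , b≢d , c≢d) m pm = begin
    adj (columnPattern a b c d) m             ≡⟨ sum-alternating (δ c d) (δ a d) (δ c b) (δ a b) (neighbours m) ⟩
    ((S c d + - S a d) + - S c b) + S a b     ≡⟨ cong₂ _+_ (cong₂ _+_ (cong₂ _+_ (S≡ c≢d) (cong -_ (S≡ a≢d)))
                                                                      (cong -_ (S≡ (≢-sym b≢c))))
                                                           (S≡ a≢b) ⟩
    ((N′ c d + - N′ a d) + - N′ c b) + N′ a b ≡⟨ constant-parts-cancel N _ _ _ _ ⟩
    - N * columnPattern a b c d m             ∎
    where
    open ≡-Reasoning
    δ : Fin n → Fin n → Table n → ℚ
    δ x y t = 𝟙 (lookup t x ≟ y)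
    S : Fin n → Fin n → ℚ
    S x y = sumℚ (map (δ x y) (neighbours m))
    N′ : Fin n → Fin n → ℚ
    N′ x y = N + - (N * δ x y m)
    S≡ : ∀ {x y} → x ≢ y → S x y ≡ N′ x y
    S≡ {x} x≢y = sum-partner m pm x (≢-sym x≢y)

  -- ξ = - N is passed explicitly below: inferring it by unification makes Agda normalise N
  module _ {F : Tab n → Vtx n} (emb : IsEmbedding (spechtRep n) F) where
    open IsEmbedding emb
    open Images emb

    -- the image of a polytabloid is a multiple of its column pattern
    ψ-isEigenvector : ∀ {a b c d} → Distinct4 a b c d → IsEigenvector (- N) (ψ a b c d)
    ψ-isEigenvector {a} {b} {c} {d} dd = isEigenvector-cong {ξ = - N} (λ _ pm → sym (f≡columnPattern pm))
                                           (isEigenvector-· {ξ = - N} (½ * β) (columnPattern-isEigenvector dd))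
      where
      reference : ∃ λ m → IsPM m × lookup m a ≡ b × lookup m c ≡ d
      reference = matching-with-edges {m₀ = m₀} pm₀ dd
      open OnePolytabloid emb dd
      open Reference {proj₁ reference} (proj₁ (proj₂ reference))
                     (proj₁ (proj₂ (proj₂ reference))) (proj₂ (proj₂ (proj₂ reference)))

    combo-isEigenvector : ∀ L → All ValidQuad L → IsEigenvector (- N) (F (combo L))
    combo-isEigenvector [] [] = isEigenvector-cong {ξ = - N} F-zero (isEigenvector-0 {ξ = - N})
      where
      F-zero : (λ _ → 0ℚ) ≈V F (combo [])
      F-zero m pm = sym (trans (scal 0ℚ ([] , [] , λ _ _ → refl) m pm) (*-zeroˡ (F (combo []) m)))
    combo-isEigenvector ((q , a , b , c , d) ∷ L) (dd ∷ valid) =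
      isEigenvector-cong {ξ = - N} F-cons
        (isEigenvector-+ {ξ = - N} (isEigenvector-· {ξ = - N} q (ψ-isEigenvector dd)) (combo-isEigenvector L valid))
      where
      F-cons : ((q ·V ψ a b c d) +V F (combo L)) ≈V F (combo ((q , a , b , c , d) ∷ L))
      F-cons m pm = sym (trans (add (single-∈ dd q (λ _ → refl)) (L , valid , λ _ _ → refl) m pm)
                               (cong (_+ F (combo L) m) (scal q (polytabloid-∈ dd) m pm)))

    specht-isEigenvector : ∀ {u} → InSpecht u → IsEigenvector (- N) (F u)
    specht-isEigenvector u-∈@(L , valid , u≈L) =
      isEigenvector-cong {ξ = - N} (λ m pm → resp (L , valid , λ _ _ → refl) u-∈ (λ s ∣s∣≡2 → sym (u≈L s ∣s∣≡2)) m pm)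
                         (combo-isEigenvector L valid)

lemma11 : ∀ (k : ℕ) (hk : 2 ≤ k) (m₀ : Table (2 ℕ.* k)) → IsPM m₀ →
    EigenvalueOn (trivialRep (2 ℕ.* k)) (+ degree m₀ / 1)
    × EigenvalueOn (spechtRep (2 ℕ.* k)) (negRatio k hk (degree m₀))
lemma11 k hk m₀ pm₀ =
  (λ _ emb q _ → trivial-isEigenvector {m₀ = m₀} pm₀ emb q) ,
  (λ _ emb _ u-∈ → Eigenvalue.specht-isEigenvector {m₀ = m₀} pm₀ {{nz hk}} emb u-∈)
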